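{- Let $\Gamma=\langle\Gamma_{i_1},\dots,\Gamma_{i_k}\rangle\subseteq\partial\sigma^{d+1}$ with $0\le i_1<i_2<\dots<i_k\le d+1$. Let $F^{(1)}_{\mathrm{in}}$ be any facet of $\Diamond(\Gamma_{i_1})$ and, for $2\le\ell\le k$, let $F^{(\ell)}_{\mathrm{in}}=\{0,\dots,i_\ell-1\}\cup\{v_{i_\ell},\dots,v_d\}$ (and $F^{(\ell)}_{\mathrm{in}}=\{0,\dots,d\}$ if $i_\ell=d+1$). For $1\le\ell\le k$ let $r_\ell=f_d(\Diamond(\Gamma_{i_\ell}))-1$ and let $F^{(\ell)}_0=F^{(\ell)}_{\mathrm{in}},F^{(\ell)}_1,\dots,F^{(\ell)}_{r_\ell}$ be the facets of $\Diamond(\Gamma_{i_\ell})$ in degree lexicographic order with respect to $F^{(\ell)}_{\mathrm{in}}$. Then $$F^{(1)}_0,F^{(1)}_1,\dots,F^{(1)}_{r_1},\dots,F^{(k)}_0,F^{(k)}_1,\dots,F^{(k)}_{r_k}$$ is a shelling order for $\Diamond(\Gamma)$.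
   Context: $\sigma^{d+1}$ is the simplex on $\{0,\dots,d+1\}$, $\Gamma_i=\{0,\dots,d+1\}\setminus\{i\}$. $\Diamond(\Gamma)$: for $i=0,\dots,d$ in order, if $F_i=\{i+1,\dots,d+1\}$ is a face of the current complex $K$, replace $K$ by $(K\setminus F_i)\cup(\langle v_i\rangle*\partial F_i*\mathrm{lk}_K(F_i))$ (new vertex $v_i$). For $i\le d$ every facet of $\Diamond(\Gamma_i)$ has the form $\{0,\dots,i-1,v_i\}\cup F'$ with $F'$ containing exactly one of $j,v_j$ for each $i<j\le d$; $\Diamond(\Gamma_{d+1})$ is the simplex $\{0,\dots,d\}$. For two facets $H,F$ of $\Diamond(\Gamma_i)$, $\varphi_F(H)\in\{0,1\}^{d-i}$ has coordinate $0$ at $j\in\{i+1,\dots,d\}$ iff $H$ and $F$ contain the same element of $\{j,v_j\}$; $\deg_F(H)$ is its number of ones. Degree lexicographic order w.r.t. $F$: $H\prec H'$ if $\deg_F(H)<\deg_F(H')$, or equal degrees and $\varphi_F(H)$ has a $0$ at the first coordinate where they differ. $f_d$ is the number of $d$-faces. A shelling order of a pure complex is an ordering $H_1,\dots,H_m$ of its facets such that for each $i$, $\{S\subseteq H_i: S\not\subseteq H_j \text{ for all } j<i\}$ has a unique minimal element. -}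

module Defs where

open import Data.Bool using (Bool; true; false; not; _∧_; _∨_)
open import Data.Nat using (ℕ; zero; suc; _<ᵇ_; _≤ᵇ_) renaming (_<_ to _<ℕ_)
open import Data.Fin using (Fin; toℕ; _↑ˡ_; _↑ʳ_; inject₁; _≟_) renaming (_<_ to _<F_)
open import Data.Fin.Subset using (Subset; _⊆_; _∪_; _∩_; ⁅_⁆; ∣_∣) renaming (⊥ to ∅)
open import Data.Vec using (Vec; tabulate; lookup; replicate; _++_)
open import Data.List using (List; []; _∷_; foldl; allFin; filter; take; length)
  renaming (lookup to lookupL)
open import Data.List.Membership.Propositional using () renaming (_∈_ to _∈ₗ_)
open import Data.List.Relation.Unary.All using (All)
open import Data.List.Relation.Unary.Any using (Any)
open import Data.List.Relation.Unary.AllPairs using (AllPairs)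
open import Data.List.Relation.Unary.Unique.Propositional using (Unique)
open import Data.Product using (Σ; _×_; ∃)
open import Data.Sum using (_⊎_)
open import Data.Empty using (⊥)
open import Data.Unit using (⊤)
open import Relation.Nullary using (¬_; ⌊_⌋)
open import Relation.Binary.PropositionalEquality using (_≡_; _≢_)

-- Vertex set for dimension d: old vertices 0..d+1, then new vertices v_0..v_d.
N : ℕ → ℕ
N d = suc (suc d) Data.Nat.+ suc d

old : ∀ {d} → Fin (suc (suc d)) → Fin (N d)
old {d} j = j ↑ˡ suc d

new : ∀ {d} → Fin (suc d) → Fin (N d)
new {d} j = suc (suc d) ↑ʳ j

Face : ℕ → Set
Face d = Subset (N d)

Complex : ℕ → Set₁
Complex d = Face d → Set

ΓSet : ∀ {d} → Fin (suc (suc d)) → Face d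
ΓSet {d} i = tabulate {n = suc (suc d)} (λ j → not ⌊ j ≟ i ⌋) ++ replicate (suc d) false

GenCx : ∀ {d} → List (Fin (suc (suc d))) → Complex d
GenCx is S = Any (λ i → S ⊆ ΓSet i) is

FSet : ∀ {d} → Fin (suc d) → Face d
FSet {d} i = tabulate {n = suc (suc d)} (λ j → toℕ i <ᵇ toℕ j) ++ replicate (suc d) false

Link : ∀ {d} → Complex d → Face d → Complex d
Link K F C = K C × (C ∩ F ≡ ∅) × K (C ∪ F)

-- (K \ F) ∪ (⟨v⟩ * ∂F * lk_K(F)); K \ F removes all faces containing F
StellarSub : ∀ {d} → Complex d → Face d → Fin (N d) → Complex d
StellarSub K F v S =
  (K S × ¬ (F ⊆ S))
  ⊎ Σ (Face _) (λ A → Σ (Face _) (λ B → Σ (Face _) (λ C →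
      A ⊆ ⁅ v ⁆ × (B ⊆ F × B ≢ F) × Link K F C × S ≡ (A ∪ B) ∪ C)))

DiamondStep : ∀ {d} → Complex d → Fin (suc d) → Complex d
DiamondStep K i S =
  (K (FSet i) × StellarSub K (FSet i) (new i) S) ⊎ (¬ K (FSet i) × K S)

Diamond : ∀ {d} → Complex d → Complex d
Diamond {d} K = foldl DiamondStep K (allFin (suc d))

IsFacet : ∀ {d} → Complex d → Face d → Set
IsFacet K H = K H × (∀ S → K S → H ⊆ S → S ≡ H)

φ : ∀ {d} → Fin (suc (suc d)) → Face d → Face d → List Bool
φ {d} i F H = Data.List.map bit (filter (λ j → toℕ i Data.Nat.<? toℕ j) (allFin (suc d)))
  where
  bit : Fin (suc d) → Bool
  bit j = not ((lookup H (old (inject₁ j)) ∧ lookup F (old (inject₁ j)))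
             ∨ (lookup H (new j) ∧ lookup F (new j)))

deg : List Bool → ℕ
deg [] = 0
deg (true ∷ bs) = suc (deg bs)
deg (false ∷ bs) = deg bs

LexLt : List Bool → List Bool → Set
LexLt [] _ = ⊥
LexLt (_ ∷ _) [] = ⊥
LexLt (false ∷ xs) (true ∷ ys) = ⊤
LexLt (true ∷ xs) (false ∷ ys) = ⊥
LexLt (false ∷ xs) (false ∷ ys) = LexLt xs ys
LexLt (true ∷ xs) (true ∷ ys) = LexLt xs ys

DegLexLt : ∀ {d} → Fin (suc (suc d)) → Face d → Face d → Face d → Set
DegLexLt i F H H' =
  (deg (φ i F H) <ℕ deg (φ i F H'))
  ⊎ (deg (φ i F H) ≡ deg (φ i F H') × LexLt (φ i F H) (φ i F H'))

DegLexEnum : ∀ {d} → Fin (suc (suc d)) → Face d → List (Face d) → Set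
DegLexEnum i F L =
  Σ (List (Face _)) (λ rest → L ≡ F ∷ rest)
  × AllPairs (DegLexLt i F) L
  × All (IsFacet (Diamond (GenCx (i ∷ [])))) L
  × (∀ H → IsFacet (Diamond (GenCx (i ∷ []))) H → H ∈ₗ L)

FIn : ∀ {d} → Fin (suc (suc d)) → Face d
FIn {d} i = tabulate {n = suc (suc d)} (λ j → toℕ j <ᵇ toℕ i) ++ tabulate (λ j → toℕ i ≤ᵇ toℕ j)

Pure : ∀ {d} → Complex d → Set
Pure K = ∀ H H' → IsFacet K H → IsFacet K H' → ∣ H ∣ ≡ ∣ H' ∣

NewFace : ∀ {d} → List (Face d) → Face d → Face d → Set
NewFace earlier H S = S ⊆ H × All (λ H' → ¬ (S ⊆ H')) earlier

MinimalNew : ∀ {d} → List (Face d) → Face d → Face d → Set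
MinimalNew earlier H M =
  NewFace earlier H M × (∀ S → NewFace earlier H S → S ⊆ M → S ≡ M)

HasUniqueMinimal : ∀ {d} → List (Face d) → Face d → Set
HasUniqueMinimal earlier H =
  Σ (Face _) (λ M → MinimalNew earlier H M × (∀ M' → MinimalNew earlier H M' → M' ≡ M))

IsShellingOrder : ∀ {d} → Complex d → List (Face d) → Set
IsShellingOrder K Hs =
  Pure K
  × Unique Hs
  × All (IsFacet K) Hs
  × (∀ H → IsFacet K H → H ∈ₗ Hs)
  × (∀ (p : Fin (length Hs)) → HasUniqueMinimal (take (toℕ p) Hs) (lookupL Hs p))

module Submission where

-- Following ◇ one step at a time shows that S is a face of ◇(⟨Γ_i : i ∈ is⟩) iff for some i ∈ is
-- it avoids the old vertex i, contains v_j only for j ≥ i, never contains both j and v_j for j > i,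
-- and misses the old vertex d+1. So the facets of ◇(Γ_i) are {0,…,i-1, v_i} ∪ F′ with one of j, v_j
-- for each i < j ≤ d, all of size d+1.
-- A facet H in the block of Γ_i has the unique minimal new face R = (H ∖ F_in) ∪ {i′ : i′ < i an
-- earlier index}. No earlier facet contains R: facets of ◇(Γ_i′) miss i′, and a facet G of the same
-- block containing R differs from F_in wherever H does, so φ(G) ≥ φ(H) coordinatewise and G does
-- not precede H. Conversely a face S ⊆ H missing a vertex of R lies in an earlier facet: trading i′
-- for v_i′ gives a facet of ◇(Γ_i′), and trading the vertex of H at a slot j for that of F_in gives a
-- facet G with φ(G) ≤ φ(H), hence before H.

open import Defs
import Algebra.Properties.CommutativeSemigroup as CommutativeSemigroupProperties
open import Data.Bool using (Bool; true; false; not; _∧_; _∨_; if_then_else_)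
open import Data.Bool.ListAction using (any)
open import Data.Bool.Properties using (∨-zeroʳ; ∧-zeroʳ; T-≡)
open import Data.Empty using (⊥-elim)
open import Data.Fin as Fin using (Fin; toℕ; fromℕ<; splitAt; inject₁)
open import Data.Fin.Properties as Fin
  using (¬∀⟶∃¬; toℕ-↑ˡ; toℕ-↑ʳ; toℕ<n; fromℕ<-toℕ; toℕ-fromℕ<; toℕ-injective; toℕ-inject₁; ↑ʳ-injective; splitAt⁻¹-↑ˡ; splitAt⁻¹-↑ʳ)
open import Data.Fin.Subset using (Subset; _⊆_; _∪_; _∩_; _─_; ⁅_⁆; ∣_∣; _∈_; _∉_) renaming (⊥ to ∅)
open import Data.Fin.Subset.Properties
  using (⊆-antisym; ⊥⊆; x∈⁅y⁆⇒x≡y; x∈⁅x⁆; _∈?_; x∈p∪q⁺; x∈p∪q⁻; x∈p∩q⁺; x∈p∩q⁻; p∩q⊆p; p∩q⊆q; p⊆p∪q; q⊆p∪q;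
         p─q⊆p; x∈p∧x∉q⇒x∈p─q)
open import Data.List as List using (List; []; _∷_; _++_; concat; foldl)
import Data.List.Properties as List
open import Data.List.Membership.Propositional using (find; lose) renaming (_∈_ to _∈ₗ_)
import Data.List.Membership.Propositional.Properties as List
open import Data.List.Relation.Binary.Pointwise as Pointwise using (Pointwise; []; _∷_)
open import Data.List.Relation.Unary.All as All using (All; []; _∷_)
import Data.List.Relation.Unary.All.Properties as All
open import Data.List.Relation.Unary.AllPairs as AllPairs using (AllPairs; []; _∷_)
import Data.List.Relation.Unary.AllPairs.Properties as AllPairs
open import Data.List.Relation.Unary.Any as Any using (Any; here; there; any?)
open import Data.List.Relation.Unary.Any.Properties using (any⁺; any⁻)
open import Data.List.Relation.Unary.Linked using (Linked)
open import Data.List.Relation.Unary.Linked.Properties using (Linked⇒AllPairs)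
open import Data.Nat using (ℕ; zero; suc; _+_; _≤_; _<_; _<ᵇ_; _≤ᵇ_; _≡ᵇ_; z≤n; s≤s; z<s; _<?_; _≤?_; _≟_)
open import Data.Nat.Properties
open import Data.Product using (Σ; _×_; _,_; proj₁; proj₂)
open import Data.Sum using (_⊎_; inj₁; inj₂; [_,_]′)
open import Data.Vec using (Vec; []; _∷_; here; there; tabulate; lookup; replicate) renaming (_++_ to _++ᵛ_)
open import Data.Vec.Properties
  using (lookup-++ˡ; lookup-++ʳ; lookup-zipWith; lookup-replicate; lookup∘tabulate; tabulate∘lookup; tabulate-cong; []=⇒lookup; lookup⇒[]=)
open import Function.Base using (case_of_)
open import Function.Bundles using (_⇔_; mk⇔; module Equivalence)
open import Relation.Binary using (tri<; tri≈; tri>)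
open import Relation.Binary.PropositionalEquality
  using (_≡_; _≢_; refl; sym; trans; cong; cong₂; subst; subst₂; module ≡-Reasoning)
open import Relation.Nullary using (¬_; yes; no; Dec; ⌊_⌋; _→-dec_)

open Equivalence using (to; from)
open CommutativeSemigroupProperties +-commutativeSemigroup using (interchange)

false≢true : false ≢ true
false≢true ()

∨≡true⁻ : ∀ {a b} → a ∨ b ≡ true → a ≡ true ⊎ b ≡ true
∨≡true⁻ {true} _ = inj₁ refl
∨≡true⁻ {false} e = inj₂ e

∨≡trueˡ : ∀ {a b} → a ≡ true → a ∨ b ≡ true
∨≡trueˡ refl = refl

∨≡trueʳ : ∀ {a b} → b ≡ true → a ∨ b ≡ true
∨≡trueʳ {a} refl = ∨-zeroʳ a

∧≡true⁻ : ∀ {a b} → a ∧ b ≡ true → a ≡ true × b ≡ true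
∧≡true⁻ {true} {true} _ = refl , refl

not≡true⁻ : ∀ {b} → not b ≡ true → b ≡ false
not≡true⁻ {false} _ = refl

≢true⇒≡false : ∀ {b} → b ≢ true → b ≡ false
≢true⇒≡false {true} b≢t = ⊥-elim (b≢t refl)
≢true⇒≡false {false} _ = refl

≡true? : (b : Bool) → Dec (b ≡ true)
≡true? true = yes refl
≡true? false = no false≢true

<ᵇ≡true : ∀ {m n} → m < n → (m <ᵇ n) ≡ true
<ᵇ≡true m<n = to T-≡ (<⇒<ᵇ m<n)

<ᵇ≡true⁻ : ∀ {m n} → (m <ᵇ n) ≡ true → m < n
<ᵇ≡true⁻ {m} {n} e = <ᵇ⇒< m n (from T-≡ e)

<ᵇ≡false : ∀ {m n} → ¬ m < n → (m <ᵇ n) ≡ false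
<ᵇ≡false m≮n = ≢true⇒≡false (λ e → m≮n (<ᵇ≡true⁻ e))

≤ᵇ≡true : ∀ {m n} → m ≤ n → (m ≤ᵇ n) ≡ true
≤ᵇ≡true m≤n = to T-≡ (≤⇒≤ᵇ m≤n)

≤ᵇ≡true⁻ : ∀ {m n} → (m ≤ᵇ n) ≡ true → m ≤ n
≤ᵇ≡true⁻ {m} {n} e = ≤ᵇ⇒≤ m n (from T-≡ e)

≤ᵇ≡false : ∀ {m n} → ¬ m ≤ n → (m ≤ᵇ n) ≡ false
≤ᵇ≡false m≰n = ≢true⇒≡false (λ e → m≰n (≤ᵇ≡true⁻ e))

≡ᵇ≡true : ∀ n → (n ≡ᵇ n) ≡ true
≡ᵇ≡true n = to T-≡ (≡⇒≡ᵇ n n refl)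

≡ᵇ≡true⁻ : ∀ {m n} → (m ≡ᵇ n) ≡ true → m ≡ n
≡ᵇ≡true⁻ {m} {n} e = ≡ᵇ⇒≡ m n (from T-≡ e)

≡ᵇ≡false : ∀ {m n} → m ≢ n → (m ≡ᵇ n) ≡ false
≡ᵇ≡false m≢n = ≢true⇒≡false (λ e → m≢n (≡ᵇ≡true⁻ e))

OneOf : Bool → Bool → Set
OneOf a b = (a ≡ true × b ≡ false) ⊎ (a ≡ false × b ≡ true)

OneOf-false₁ : ∀ {a b} → OneOf a b → a ≡ false → b ≡ true
OneOf-false₁ (inj₁ (refl , _)) ()
OneOf-false₁ (inj₂ (_ , b≡true)) _ = b≡true

OneOf-false₂ : ∀ {a b} → OneOf a b → b ≡ false → a ≡ true
OneOf-false₂ (inj₁ (a≡true , _)) _ = a≡true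
OneOf-false₂ (inj₂ (_ , refl)) ()

OneOf-true₂ : ∀ {a b} → OneOf a b → b ≡ true → a ≡ false
OneOf-true₂ (inj₁ (_ , refl)) ()
OneOf-true₂ (inj₂ (a≡false , _)) _ = a≡false

oneIf : Bool → ℕ
oneIf true = 1
oneIf false = 0

countBits : (ℕ → Bool) → ℕ → ℕ
countBits f zero = 0
countBits f (suc n) = oneIf (f 0) + countBits (λ k → f (suc k)) n

countBits-snoc : ∀ f n → countBits f (suc n) ≡ countBits f n + oneIf (f n)
countBits-snoc f zero = +-comm (oneIf (f 0)) 0
countBits-snoc f (suc n) = trans (cong (oneIf (f 0) +_) (countBits-snoc (λ k → f (suc k)) n)) (sym (+-assoc (oneIf (f 0)) _ _))

oneIf-exactly-one : ∀ {a b} → OneOf a b → oneIf a + oneIf b ≡ 1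
oneIf-exactly-one (inj₁ (refl , refl)) = refl
oneIf-exactly-one (inj₂ (refl , refl)) = refl

countBits-complementary : ∀ f g n → (∀ k → k < n → oneIf (f k) + oneIf (g k) ≡ 1) → countBits f n + countBits g n ≡ n
countBits-complementary f g zero _ = refl
countBits-complementary f g (suc n) one = begin
  (oneIf (f 0) + countBits f′ n) + (oneIf (g 0) + countBits g′ n)
    ≡⟨ interchange (oneIf (f 0)) (countBits f′ n) (oneIf (g 0)) (countBits g′ n) ⟩
  (oneIf (f 0) + oneIf (g 0)) + (countBits f′ n + countBits g′ n)
    ≡⟨ cong₂ _+_ (one 0 z<s) (countBits-complementary f′ g′ n (λ k k<n → one (suc k) (s≤s k<n))) ⟩
  suc n
    ∎
  where
  open ≡-Reasoning
  f′ g′ : ℕ → Bool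
  f′ k = f (suc k)
  g′ k = g (suc k)

∣++∣ : ∀ {m n} (p : Subset m) (q : Subset n) → ∣ p ++ᵛ q ∣ ≡ ∣ p ∣ + ∣ q ∣
∣++∣ [] q = refl
∣++∣ (true ∷ p) q = cong suc (∣++∣ p q)
∣++∣ (false ∷ p) q = ∣++∣ p q

∣tabulate∣ : ∀ n (f : ℕ → Bool) → ∣ tabulate {n = n} (λ j → f (toℕ j)) ∣ ≡ countBits f n
∣tabulate∣ zero f = refl
∣tabulate∣ (suc n) f with f 0 | ∣tabulate∣ n (λ k → f (suc k))
... | true | eq = cong suc eq
... | false | eq = eq

_≽_ : List Bool → List Bool → Set
_≽_ = Pointwise (λ x y → y ≡ true → x ≡ true)

≽-refl : ∀ {xs} → xs ≽ xs
≽-refl = Pointwise.refl (λ e → e)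

map-≽ : ∀ {A : Set} (f g : A → Bool) {xs} → All (λ x → g x ≡ true → f x ≡ true) xs → List.map f xs ≽ List.map g xs
map-≽ f g [] = []
map-≽ f g (g⇒f ∷ rest) = g⇒f ∷ map-≽ f g rest

≽⇒deg≤ : ∀ {xs ys} → xs ≽ ys → deg ys ≤ deg xs
≽⇒deg≤ [] = z≤n
≽⇒deg≤ {true ∷ _} {true ∷ _} (_ ∷ rest) = s≤s (≽⇒deg≤ rest)
≽⇒deg≤ {true ∷ _} {false ∷ _} (_ ∷ rest) = m≤n⇒m≤1+n (≽⇒deg≤ rest)
≽⇒deg≤ {false ∷ _} {true ∷ _} (y⇒x ∷ _) = ⊥-elim (false≢true (y⇒x refl))
≽⇒deg≤ {false ∷ _} {false ∷ _} (_ ∷ rest) = ≽⇒deg≤ rest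

≽⇒¬LexLt : ∀ {xs ys} → xs ≽ ys → ¬ LexLt xs ys
≽⇒¬LexLt {true ∷ _} {true ∷ _} (_ ∷ rest) = ≽⇒¬LexLt rest
≽⇒¬LexLt {false ∷ _} {true ∷ _} (y⇒x ∷ _) _ = false≢true (y⇒x refl)
≽⇒¬LexLt {false ∷ _} {false ∷ _} (_ ∷ rest) = ≽⇒¬LexLt rest

slotDiffers : Bool → Bool → Bool → Bool → Bool
slotDiffers oH nH oF nF = not ((oH ∧ oF) ∨ (nH ∧ nF))

OneOf⇒¬slotDiffers : ∀ {a b} → OneOf a b → slotDiffers a b a b ≡ false
OneOf⇒¬slotDiffers (inj₁ (refl , refl)) = refl
OneOf⇒¬slotDiffers (inj₂ (refl , refl)) = refl

slotDiffers-transfer : ∀ {oH nH oG nG} oF nF → OneOf oH nH → OneOf oG nG →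
                       (oH ∧ not oF ≡ true → oG ≡ true) → (nH ∧ not nF ≡ true → nG ≡ true) →
                       slotDiffers oH nH oF nF ≡ true → slotDiffers oG nG oF nF ≡ true
slotDiffers-transfer oF nF (inj₁ (refl , refl)) (inj₁ (refl , refl)) _ _ H-differs = H-differs
slotDiffers-transfer oF nF (inj₂ (refl , refl)) (inj₂ (refl , refl)) _ _ H-differs = H-differs
slotDiffers-transfer false nF (inj₁ (refl , refl)) (inj₂ (refl , refl)) keeps-old _ _ = ⊥-elim (false≢true (keeps-old refl))
slotDiffers-transfer oF false (inj₂ (refl , refl)) (inj₁ (refl , refl)) _ keeps-new _ = ⊥-elim (false≢true (keeps-new refl))

x∈p─q⇒x∉q : ∀ {n} (p q : Subset n) {x} → x ∈ p ─ q → x ∉ q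
x∈p─q⇒x∉q (_ ∷ p) (_ ∷ q) (there x∈p─q) (there x∈q) = x∈p─q⇒x∉q p q x∈p─q x∈q

─∩-disjoint : ∀ {n} (p q r : Subset n) → r ⊆ q → (p ─ q) ∩ r ≡ ∅
─∩-disjoint p q r r⊆q = ⊆-antisym disjoint ⊥⊆
  where
  disjoint : (p ─ q) ∩ r ⊆ ∅
  disjoint x∈ = let x∈p─q , x∈r = x∈p∩q⁻ (p ─ q) r x∈ in ⊥-elim (x∈p─q⇒x∉q p q x∈p─q (r⊆q x∈r))

-- The decomposition A ∪ B ∪ C of StellarSub for a face p containing the cone point x.
∈⇒≡cone-split : ∀ {n} (p q : Subset n) {x} → x ∈ p → p ≡ (⁅ x ⁆ ∪ (p ∩ q)) ∪ (p ─ (q ∪ ⁅ x ⁆))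
∈⇒≡cone-split p q {x} x∈p = ⊆-antisym split join
  where
  split : p ⊆ (⁅ x ⁆ ∪ (p ∩ q)) ∪ (p ─ (q ∪ ⁅ x ⁆))
  split {y} y∈p with y ∈? q | y Fin.≟ x
  ... | yes y∈q | _ = x∈p∪q⁺ (inj₁ (x∈p∪q⁺ (inj₂ (x∈p∩q⁺ (y∈p , y∈q)))))
  ... | no _ | yes refl = x∈p∪q⁺ (inj₁ (x∈p∪q⁺ (inj₁ (x∈⁅x⁆ y))))
  ... | no y∉q | no y≢x = x∈p∪q⁺ (inj₂ (x∈p∧x∉q⇒x∈p─q y∈p y∉q∪⁅x⁆))
    where
    y∉q∪⁅x⁆ : y ∉ q ∪ ⁅ x ⁆
    y∉q∪⁅x⁆ y∈ = [ y∉q , (λ y∈⁅x⁆ → y≢x (x∈⁅y⁆⇒x≡y x y∈⁅x⁆)) ]′ (x∈p∪q⁻ q ⁅ x ⁆ y∈)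
  join : (⁅ x ⁆ ∪ (p ∩ q)) ∪ (p ─ (q ∪ ⁅ x ⁆)) ⊆ p
  join y∈ with x∈p∪q⁻ _ _ y∈
  ... | inj₂ y∈p─ = p─q⊆p p _ y∈p─
  ... | inj₁ y∈ with x∈p∪q⁻ ⁅ x ⁆ (p ∩ q) y∈
  ...   | inj₁ y∈⁅x⁆ rewrite x∈⁅y⁆⇒x≡y x y∈⁅x⁆ = x∈p
  ...   | inj₂ y∈p∩q = p∩q⊆p p q y∈p∩q

module _ {A : Set} where
  ++-≡-∷-split : ∀ (xs ys pre : List A) H post → xs ++ ys ≡ pre ++ H ∷ post →
                 (Σ (List A) λ pre′ → pre ≡ xs ++ pre′ × ys ≡ pre′ ++ H ∷ post) ⊎
                 (Σ (List A) λ post′ → xs ≡ pre ++ H ∷ post′)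
  ++-≡-∷-split [] ys pre H post eq = inj₁ (pre , refl , eq)
  ++-≡-∷-split (x ∷ xs) ys [] H post eq = inj₂ (xs , cong (_∷ xs) (List.∷-injectiveˡ eq))
  ++-≡-∷-split (x ∷ xs) ys (p ∷ pre) H post eq with ++-≡-∷-split xs ys pre H post (List.∷-injectiveʳ eq)
  ... | inj₁ (pre′ , pre≡ , ys≡) = inj₁ (pre′ , cong₂ _∷_ (sym (List.∷-injectiveˡ eq)) pre≡ , ys≡)
  ... | inj₂ (post′ , xs≡) = inj₂ (post′ , cong₂ _∷_ (List.∷-injectiveˡ eq) xs≡)

  ≡take++lookup∷drop : ∀ (xs : List A) (p : Fin (List.length xs)) →
                      xs ≡ List.take (toℕ p) xs ++ List.lookup xs p ∷ List.drop (suc (toℕ p)) xs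
  ≡take++lookup∷drop (x ∷ xs) Fin.zero = refl
  ≡take++lookup∷drop (x ∷ xs) (Fin.suc p) = cong (x ∷_) (≡take++lookup∷drop xs p)

  AllPairs-around : ∀ {R : A → A → Set} pre H post → AllPairs R (pre ++ H ∷ post) → All (λ G → R G H) pre × All (R H) post
  AllPairs-around [] H post (H-R ∷ _) = [] , H-R
  AllPairs-around (G ∷ pre) H post (G-R ∷ rest) =
    let pre-R , post-R = AllPairs-around pre H post rest in All.lookup G-R (List.∈-++⁺ʳ pre (here refl)) ∷ pre-R , post-R

module Coordinates (d : ℕ) where

  D₁ D₂ : ℕ
  D₁ = suc d
  D₂ = suc D₁

  -- Old vertex k and new vertex v_k, read as bits indexed by ℕ; indices out of range read false.
  oldBit newBit : Face d → ℕ → Bool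
  oldBit S k with k <? D₂
  ... | yes k<D₂ = lookup S (old (fromℕ< k<D₂))
  ... | no _ = false
  newBit S k with k <? D₁
  ... | yes k<D₁ = lookup S (new (fromℕ< k<D₁))
  ... | no _ = false

  _∋old_ _∋new_ : Face d → ℕ → Set
  S ∋old k = oldBit S k ≡ true
  S ∋new k = newBit S k ≡ true

  oldBit-lookup : ∀ S (j : Fin D₂) → lookup S (old j) ≡ oldBit S (toℕ j)
  oldBit-lookup S j with toℕ j <? D₂
  ... | yes j<D₂ = cong (λ z → lookup S (old z)) (sym (fromℕ<-toℕ j j<D₂))
  ... | no j≮D₂ = ⊥-elim (j≮D₂ (toℕ<n j))

  newBit-lookup : ∀ S (j : Fin D₁) → lookup S (new j) ≡ newBit S (toℕ j)
  newBit-lookup S j with toℕ j <? D₁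
  ... | yes j<D₁ = cong (λ z → lookup S (new z)) (sym (fromℕ<-toℕ j j<D₁))
  ... | no j≮D₁ = ⊥-elim (j≮D₁ (toℕ<n j))

  oldBit-≥ : ∀ S k → D₂ ≤ k → oldBit S k ≡ false
  oldBit-≥ S k D₂≤k with k <? D₂
  ... | yes k<D₂ = ⊥-elim (<⇒≱ k<D₂ D₂≤k)
  ... | no _ = refl

  newBit-≥ : ∀ S k → D₁ ≤ k → newBit S k ≡ false
  newBit-≥ S k D₁≤k with k <? D₁
  ... | yes k<D₁ = ⊥-elim (<⇒≱ k<D₁ D₁≤k)
  ... | no _ = refl

  ∋old⇒< : ∀ S k → S ∋old k → k < D₂
  ∋old⇒< S k e with k <? D₂
  ... | yes k<D₂ = k<D₂
  ... | no _ = ⊥-elim (false≢true e)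

  ∋new⇒< : ∀ S k → S ∋new k → k < D₁
  ∋new⇒< S k e with k <? D₁
  ... | yes k<D₁ = k<D₁
  ... | no _ = ⊥-elim (false≢true e)

  data VertexView : Fin (N d) → Set where
    old-vertex : (j : Fin D₂) → VertexView (old j)
    new-vertex : (j : Fin D₁) → VertexView (new j)

  vertexView : ∀ x → VertexView x
  vertexView x with splitAt D₂ x in eq
  ... | inj₁ j = subst VertexView (splitAt⁻¹-↑ˡ eq) (old-vertex j)
  ... | inj₂ j = subst VertexView (splitAt⁻¹-↑ʳ eq) (new-vertex j)

  oldBit≡-from-range : ∀ S T k → (k < D₂ → oldBit S k ≡ oldBit T k) → oldBit S k ≡ oldBit T k
  oldBit≡-from-range S T k h with k <? D₂
  ... | yes k<D₂ = h k<D₂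
  ... | no _ = refl

  newBit≡-from-range : ∀ S T k → (k < D₁ → newBit S k ≡ newBit T k) → newBit S k ≡ newBit T k
  newBit≡-from-range S T k h with k <? D₁
  ... | yes k<D₁ = h k<D₁
  ... | no _ = refl

  face-ext : ∀ S T → (∀ k → k < D₂ → oldBit S k ≡ oldBit T k) → (∀ k → k < D₁ → newBit S k ≡ newBit T k) → S ≡ T
  face-ext S T ho hn = trans (sym (tabulate∘lookup S)) (trans (tabulate-cong pointwise) (tabulate∘lookup T))
    where
    pointwise : ∀ x → lookup S x ≡ lookup T x
    pointwise x with vertexView x
    ... | old-vertex j = trans (oldBit-lookup S j) (trans (ho (toℕ j) (toℕ<n j)) (sym (oldBit-lookup T j)))
    ... | new-vertex j = trans (newBit-lookup S j) (trans (hn (toℕ j) (toℕ<n j)) (sym (newBit-lookup T j)))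

  oldBit-++ : ∀ (u : Vec Bool D₂) (v : Vec Bool D₁) k (k<D₂ : k < D₂) → oldBit (u ++ᵛ v) k ≡ lookup u (fromℕ< k<D₂)
  oldBit-++ u v k k<D₂ with k <? D₂
  ... | yes p = lookup-++ˡ u v (fromℕ< p)
  ... | no k≮D₂ = ⊥-elim (k≮D₂ k<D₂)

  newBit-++ : ∀ (u : Vec Bool D₂) (v : Vec Bool D₁) k (k<D₁ : k < D₁) → newBit (u ++ᵛ v) k ≡ lookup v (fromℕ< k<D₁)
  newBit-++ u v k k<D₁ with k <? D₁
  ... | yes p = lookup-++ʳ u v (fromℕ< p)
  ... | no k≮D₁ = ⊥-elim (k≮D₁ k<D₁)

  lookup-tabulate-toℕ : ∀ {n} (f : ℕ → Bool) {k} (k<n : k < n) → lookup (tabulate {n = n} (λ j → f (toℕ j))) (fromℕ< k<n) ≡ f k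
  lookup-tabulate-toℕ f k<n = trans (lookup∘tabulate (λ j → f (toℕ j)) (fromℕ< k<n)) (cong f (toℕ-fromℕ< k<n))

  ∌new-++-replicate : ∀ u k → ¬ (u ++ᵛ replicate D₁ false) ∋new k
  ∌new-++-replicate u k e =
    false≢true (trans (sym (trans (newBit-++ u (replicate D₁ false) k k<D₁) (lookup-replicate (fromℕ< k<D₁) false))) e)
    where k<D₁ = ∋new⇒< (u ++ᵛ replicate D₁ false) k e

  fromBits : (ℕ → Bool) → (ℕ → Bool) → Face d
  fromBits o n = tabulate {n = D₂} (λ j → o (toℕ j)) ++ᵛ tabulate {n = D₁} (λ j → n (toℕ j))

  oldBit-fromBits : ∀ o n k → k < D₂ → oldBit (fromBits o n) k ≡ o k
  oldBit-fromBits o n k k<D₂ =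
    trans (oldBit-++ (tabulate (λ j → o (toℕ j))) (tabulate (λ j → n (toℕ j))) k k<D₂) (lookup-tabulate-toℕ o k<D₂)

  newBit-fromBits : ∀ o n k → k < D₁ → newBit (fromBits o n) k ≡ n k
  newBit-fromBits o n k k<D₁ =
    trans (newBit-++ (tabulate (λ j → o (toℕ j))) (tabulate (λ j → n (toℕ j))) k k<D₁) (lookup-tabulate-toℕ n k<D₁)

  fromBits-bits : ∀ S → fromBits (oldBit S) (newBit S) ≡ S
  fromBits-bits S = face-ext _ S (λ k → oldBit-fromBits (oldBit S) (newBit S) k) (λ k → newBit-fromBits (oldBit S) (newBit S) k)

  ∣fromBits∣ : ∀ o b → ∣ fromBits o b ∣ ≡ countBits o D₂ + countBits b D₁
  ∣fromBits∣ o b = trans (∣++∣ (tabulate {n = D₂} (λ j → o (toℕ j))) (tabulate {n = D₁} (λ j → b (toℕ j))))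
                         (cong₂ _+_ (∣tabulate∣ D₂ o) (∣tabulate∣ D₁ b))

  oldBit-∪ : ∀ S T k → oldBit (S ∪ T) k ≡ oldBit S k ∨ oldBit T k
  oldBit-∪ S T k with k <? D₂
  ... | yes p = lookup-zipWith _∨_ (old (fromℕ< p)) S T
  ... | no _ = refl

  newBit-∪ : ∀ S T k → newBit (S ∪ T) k ≡ newBit S k ∨ newBit T k
  newBit-∪ S T k with k <? D₁
  ... | yes p = lookup-zipWith _∨_ (new (fromℕ< p)) S T
  ... | no _ = refl

  oldBit-∩ : ∀ S T k → oldBit (S ∩ T) k ≡ oldBit S k ∧ oldBit T k
  oldBit-∩ S T k with k <? D₂
  ... | yes p = lookup-zipWith _∧_ (old (fromℕ< p)) S T
  ... | no _ = refl

  newBit-∩ : ∀ S T k → newBit (S ∩ T) k ≡ newBit S k ∧ newBit T k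
  newBit-∩ S T k with k <? D₁
  ... | yes p = lookup-zipWith _∧_ (new (fromℕ< p)) S T
  ... | no _ = refl

  oldBit-∅ : ∀ k → oldBit ∅ k ≡ false
  oldBit-∅ k with k <? D₂
  ... | yes p = lookup-replicate (old (fromℕ< p)) false
  ... | no _ = refl

  newBit-∅ : ∀ k → newBit ∅ k ≡ false
  newBit-∅ k with k <? D₁
  ... | yes p = lookup-replicate (new (fromℕ< p)) false
  ... | no _ = refl

  ∪∋old⁻ : ∀ S T k → (S ∪ T) ∋old k → S ∋old k ⊎ T ∋old k
  ∪∋old⁻ S T k e = ∨≡true⁻ (trans (sym (oldBit-∪ S T k)) e)

  ∪∋new⁻ : ∀ S T k → (S ∪ T) ∋new k → S ∋new k ⊎ T ∋new k
  ∪∋new⁻ S T k e = ∨≡true⁻ (trans (sym (newBit-∪ S T k)) e)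

  ∩≡∅⇒∌old : ∀ S T → S ∩ T ≡ ∅ → ∀ k → S ∋old k → ¬ T ∋old k
  ∩≡∅⇒∌old S T S∩T≡∅ k e₁ e₂ = false≢true (begin
    false                    ≡⟨ sym (oldBit-∅ k) ⟩
    oldBit ∅ k               ≡⟨ cong (λ U → oldBit U k) (sym S∩T≡∅) ⟩
    oldBit (S ∩ T) k         ≡⟨ oldBit-∩ S T k ⟩
    oldBit S k ∧ oldBit T k  ≡⟨ cong₂ _∧_ e₁ e₂ ⟩
    true                     ∎)
    where open ≡-Reasoning

  ∩≡∅⇒∌new : ∀ S T → S ∩ T ≡ ∅ → ∀ k → S ∋new k → ¬ T ∋new k
  ∩≡∅⇒∌new S T S∩T≡∅ k e₁ e₂ = false≢true (begin
    false                    ≡⟨ sym (newBit-∅ k) ⟩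
    newBit ∅ k               ≡⟨ cong (λ U → newBit U k) (sym S∩T≡∅) ⟩
    newBit (S ∩ T) k         ≡⟨ newBit-∩ S T k ⟩
    newBit S k ∧ newBit T k  ≡⟨ cong₂ _∧_ e₁ e₂ ⟩
    true                     ∎)
    where open ≡-Reasoning

  record _⊑_ (S T : Face d) : Set where
    constructor _,_
    field
      old⊑ : ∀ k → S ∋old k → T ∋old k
      new⊑ : ∀ k → S ∋new k → T ∋new k
  open _⊑_ public

  ∋new⇒∈ : ∀ S (j : Fin D₁) → S ∋new toℕ j → new j ∈ S
  ∋new⇒∈ S j e = lookup⇒[]= (new j) S (trans (newBit-lookup S j) e)

  ⊆⇒⊑ : ∀ {S T} → S ⊆ T → S ⊑ T
  ⊆⇒⊑ {S} {T} S⊆T = onOld , onNew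
    where
    onOld : ∀ k → S ∋old k → T ∋old k
    onOld k e with k <? D₂
    ... | yes _ = []=⇒lookup (S⊆T (lookup⇒[]= _ S e))
    ... | no _ = e
    onNew : ∀ k → S ∋new k → T ∋new k
    onNew k e with k <? D₁
    ... | yes _ = []=⇒lookup (S⊆T (lookup⇒[]= _ S e))
    ... | no _ = e

  ⊑⇒⊆ : ∀ {S T} → S ⊑ T → S ⊆ T
  ⊑⇒⊆ {S} {T} S⊑T {x} x∈S = lookup⇒[]= x T (pointwise x (vertexView x) ([]=⇒lookup x∈S))
    where
    pointwise : ∀ x → VertexView x → lookup S x ≡ true → lookup T x ≡ true
    pointwise .(old j) (old-vertex j) e = trans (oldBit-lookup T j) (old⊑ S⊑T (toℕ j) (trans (sym (oldBit-lookup S j)) e))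
    pointwise .(new j) (new-vertex j) e = trans (newBit-lookup T j) (new⊑ S⊑T (toℕ j) (trans (sym (newBit-lookup S j)) e))

  ⊑-antisym : ∀ {S T} → S ⊑ T → T ⊑ S → S ≡ T
  ⊑-antisym S⊑T T⊑S = ⊆-antisym (⊑⇒⊆ S⊑T) (⊑⇒⊆ T⊑S)

module NamedFaces (d : ℕ) where
  open Coordinates d

  old≢new : ∀ (j : Fin D₂) (m : Fin D₁) → old {d} j ≢ new m
  old≢new j m eq = <⇒≱ (toℕ<n j) (begin
    D₂             ≤⟨ m≤m+n D₂ (toℕ m) ⟩
    D₂ + toℕ m     ≡⟨ sym (toℕ-↑ʳ D₂ m) ⟩
    toℕ (new {d} m) ≡⟨ cong toℕ (sym eq) ⟩
    toℕ (old {d} j) ≡⟨ toℕ-↑ˡ j D₁ ⟩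
    toℕ j          ∎)
    where open ≤-Reasoning


  private
    oldBit-FSet : ∀ m k (k<D₂ : k < D₂) → oldBit (FSet m) k ≡ (toℕ m <ᵇ k)
    oldBit-FSet m k k<D₂ =
      trans (oldBit-++ (tabulate (λ j → toℕ m <ᵇ toℕ j)) (replicate D₁ false) k k<D₂) (lookup-tabulate-toℕ (toℕ m <ᵇ_) k<D₂)

    oldBit-ΓSet : ∀ i k (k<D₂ : k < D₂) → oldBit (ΓSet i) k ≡ not ⌊ fromℕ< k<D₂ Fin.≟ i ⌋
    oldBit-ΓSet i k k<D₂ =
      trans (oldBit-++ (tabulate (λ j → not ⌊ j Fin.≟ i ⌋)) (replicate D₁ false) k k<D₂)
            (lookup∘tabulate (λ j → not ⌊ j Fin.≟ i ⌋) (fromℕ< k<D₂))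

  FSet∋old : ∀ m k → toℕ m < k → k < D₂ → FSet m ∋old k
  FSet∋old m k m<k k<D₂ = trans (oldBit-FSet m k k<D₂) (<ᵇ≡true m<k)

  FSet∋old⇒> : ∀ m k → FSet m ∋old k → toℕ m < k
  FSet∋old⇒> m k e = <ᵇ≡true⁻ (trans (sym (oldBit-FSet m k (∋old⇒< (FSet m) k e))) e)

  FSet∌old : ∀ m → oldBit (FSet m) (toℕ m) ≡ false
  FSet∌old m = ≢true⇒≡false (λ e → <-irrefl refl (FSet∋old⇒> m (toℕ m) e))

  FSet∌new : ∀ m k → ¬ FSet m ∋new k
  FSet∌new m = ∌new-++-replicate (tabulate (λ j → toℕ m <ᵇ toℕ j))

  ΓSet∌new : ∀ i k → ¬ ΓSet i ∋new k
  ΓSet∌new i = ∌new-++-replicate (tabulate (λ j → not ⌊ j Fin.≟ i ⌋))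

  ΓSet∋old⇒≢ : ∀ i k → ΓSet i ∋old k → k ≢ toℕ i
  ΓSet∋old⇒≢ i k e k≡i with fromℕ< k<D₂ Fin.≟ i | oldBit-ΓSet i k k<D₂
    where k<D₂ = ∋old⇒< (ΓSet i) k e
  ... | yes _ | eq = false≢true (trans (sym eq) e)
  ... | no ≢i | _ = ≢i (toℕ-injective (trans (toℕ-fromℕ< (∋old⇒< (ΓSet i) k e)) k≡i))

  ΓSet∋old : ∀ i k → k < D₂ → k ≢ toℕ i → ΓSet i ∋old k
  ΓSet∋old i k k<D₂ k≢i with fromℕ< k<D₂ Fin.≟ i | oldBit-ΓSet i k k<D₂
  ... | yes eq | _ = ⊥-elim (k≢i (trans (sym (toℕ-fromℕ< k<D₂)) (cong toℕ eq)))
  ... | no _ | eq = eq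

  ⁅new⁆∌old : ∀ m k → oldBit ⁅ new m ⁆ k ≡ false
  ⁅new⁆∌old m k with k <? D₂
  ... | yes p = ≢true⇒≡false (λ e → old≢new (fromℕ< p) m (x∈⁅y⁆⇒x≡y (new m) (lookup⇒[]= _ ⁅ new m ⁆ e)))
  ... | no _ = refl

  ⁅new⁆∋new⇒≡ : ∀ m k → ⁅ new m ⁆ ∋new k → k ≡ toℕ m
  ⁅new⁆∋new⇒≡ m k e with k <? D₁
  ... | yes p = trans (sym (toℕ-fromℕ< p)) (cong toℕ (↑ʳ-injective D₂ _ _ (x∈⁅y⁆⇒x≡y (new m) (lookup⇒[]= _ ⁅ new m ⁆ e))))
  ... | no _ = ⊥-elim (false≢true e)

  ⁅new⁆∋new : ∀ m → ⁅ new m ⁆ ∋new toℕ m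
  ⁅new⁆∋new m = trans (sym (newBit-lookup ⁅ new m ⁆ m)) ([]=⇒lookup (x∈⁅x⁆ (new m)))


module Stages (d : ℕ) where
  open Coordinates d
  open NamedFaces d

  Omits : ℕ → Face d → Set
  Omits m S = Σ ℕ λ k → m ≤ k × k < D₂ × oldBit S k ≡ false

  Omits-weaken : ∀ {m S} → Omits (suc m) S → Omits m S
  Omits-weaken (k , m<k , k<D₂ , e) = k , <⇒≤ m<k , k<D₂ , e

  -- The faces of the complex obtained from ⟨Γ_t⟩ by the steps j < m of ◇. Only the steps
  -- t ≤ j < m act, since F_j ⊆ Γ_t iff t ≤ j; for m ≤ t the conditions say exactly S ⊆ Γ_t.
  record StageFace (t m : ℕ) (S : Face d) : Set where
    constructor stageFace
    field
      avoids    : ∀ k → S ∋old k → k ≢ t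
      new-range : ∀ k → S ∋new k → t ≤ k × k < m
      exclusive : ∀ k → t < k → S ∋old k → ¬ S ∋new k
      omits     : Omits m S
  open StageFace public

  StageFaceOf : ℕ → List (Fin D₂) → Face d → Set
  StageFaceOf m is S = Any (λ i → StageFace (toℕ i) m S) is

  StageFace-⊑ : ∀ {t m S T} → S ⊑ T → StageFace t m T → StageFace t m S
  StageFace-⊑ S⊑T (stageFace avoids new-range exclusive (k , m≤k , k<D₂ , k∉T)) = stageFace
    (λ k e → avoids k (old⊑ S⊑T k e))
    (λ k e → new-range k (new⊑ S⊑T k e))
    (λ k t<k e₁ e₂ → exclusive k t<k (old⊑ S⊑T k e₁) (new⊑ S⊑T k e₂))
    (k , m≤k , k<D₂ , ≢true⇒≡false (λ k∈S → false≢true (trans (sym k∉T) (old⊑ S⊑T k k∈S))))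

  ⊆ΓSet⇔StageFace₀ : ∀ (i : Fin D₂) S → (S ⊆ ΓSet i) ⇔ StageFace (toℕ i) 0 S
  ⊆ΓSet⇔StageFace₀ i S = mk⇔ forward backward
    where
    forward : S ⊆ ΓSet i → StageFace (toℕ i) 0 S
    forward S⊆Γ = stageFace
      (λ k e → ΓSet∋old⇒≢ i k (old⊑ (⊆⇒⊑ S⊆Γ) k e))
      (λ k e → ⊥-elim (ΓSet∌new i k (new⊑ (⊆⇒⊑ S⊆Γ) k e)))
      (λ k _ _ e → ΓSet∌new i k (new⊑ (⊆⇒⊑ S⊆Γ) k e))
      (toℕ i , z≤n , toℕ<n i , ≢true⇒≡false (λ e → ΓSet∋old⇒≢ i (toℕ i) (old⊑ (⊆⇒⊑ S⊆Γ) (toℕ i) e) refl))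
    backward : StageFace (toℕ i) 0 S → S ⊆ ΓSet i
    backward st = ⊑⇒⊆ ((λ k e → ΓSet∋old i k (∋old⇒< S k e) (avoids st k e)) ,
                   (λ k e → ⊥-elim (n≮0 (proj₂ (new-range st k e)))))

  module Step (m : Fin D₁) where
    s : ℕ
    s = toℕ m

    Fₘ vₘ : Face d
    Fₘ = FSet m
    vₘ = ⁅ new m ⁆

    s<D₂ : s < D₂
    s<D₂ = m<n⇒m<1+n (toℕ<n m)

    Fₘ-StageFace⇒≤ : ∀ {t} → t < D₂ → StageFace t s Fₘ → t ≤ s
    Fₘ-StageFace⇒≤ {t} t<D₂ st with t ≤? s
    ... | yes t≤s = t≤s
    ... | no t≰s = ⊥-elim (avoids st t (FSet∋old m t (≰⇒> t≰s) t<D₂) refl)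

    Fₘ-StageFace : ∀ {t} → t ≤ s → StageFace t s Fₘ
    Fₘ-StageFace t≤s = stageFace
      (λ k e → >⇒≢ (≤-<-trans t≤s (FSet∋old⇒> m k e)))
      (λ k e → ⊥-elim (FSet∌new m k e))
      (λ k _ _ e → FSet∌new m k e)
      (s , ≤-refl , s<D₂ , FSet∌old m)

    omits⇒⊈Fₘ : ∀ S → Omits (suc s) S → ¬ Fₘ ⊆ S
    omits⇒⊈Fₘ S (k , s<k , k<D₂ , k∉S) Fₘ⊆S =
      false≢true (trans (sym k∉S) (old⊑ (⊆⇒⊑ Fₘ⊆S) k (FSet∋old m k s<k k<D₂)))

    ⊈Fₘ⇒omits : ∀ S → ¬ Fₘ ⊆ S → Omits (suc s) S
    ⊈Fₘ⇒omits S Fₘ⊈S with ¬∀⟶∃¬ D₂ AboveIn AboveIn? (λ all → Fₘ⊈S (⊑⇒⊆ (Fₘ⊑S all)))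
      where
      AboveIn : Fin D₂ → Set
      AboveIn j = s < toℕ j → S ∋old toℕ j
      AboveIn? : ∀ j → Dec (AboveIn j)
      AboveIn? j = (s <? toℕ j) →-dec (≡true? (oldBit S (toℕ j)))
      Fₘ⊑S : (∀ j → AboveIn j) → Fₘ ⊑ S
      Fₘ⊑S all = old-part , (λ k e → ⊥-elim (FSet∌new m k e))
        where
        old-part : ∀ k → Fₘ ∋old k → S ∋old k
        old-part k e =
          subst (S ∋old_) (toℕ-fromℕ< k<D₂) (all (fromℕ< k<D₂) (subst (s <_) (sym (toℕ-fromℕ< k<D₂)) (FSet∋old⇒> m k e)))
          where k<D₂ = ∋old⇒< Fₘ k e
    ... | j , ¬AboveIn with s <? toℕ j | ≡true? (oldBit S (toℕ j))
    ...   | yes s<j | no j∉S = toℕ j , s<j , toℕ<n j , ≢true⇒≡false j∉S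
    ...   | no s≮j | _ = ⊥-elim (¬AboveIn (λ s<j → ⊥-elim (s≮j s<j)))
    ...   | _ | yes j∈S = ⊥-elim (¬AboveIn (λ _ → j∈S))

    StageFace-skip : ∀ {t S} → t < D₂ → s < t → StageFace t s S ⇔ StageFace t (suc s) S
    StageFace-skip {t} {S} t<D₂ s<t = mk⇔ forward backward
      where
      t∉S : StageFace t s S → oldBit S t ≡ false
      t∉S st = ≢true⇒≡false (λ e → avoids st t e refl)
      forward : StageFace t s S → StageFace t (suc s) S
      forward st = stageFace (avoids st)
        (λ k e → ⊥-elim (<⇒≱ s<t (≤-trans (proj₁ (new-range st k e)) (<⇒≤ (proj₂ (new-range st k e))))))
        (exclusive st) (t , s<t , t<D₂ , t∉S st)
      backward : StageFace t (suc s) S → StageFace t s S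
      backward st = stageFace (avoids st)
        (λ k e → ⊥-elim (<⇒≱ s<t (≤-trans (proj₁ (new-range st k e)) (m<1+n⇒m≤n (proj₂ (new-range st k e))))))
        (exclusive st) (Omits-weaken (omits st))

    StageFace-keep : ∀ {t S} → StageFace t s S → Omits (suc s) S → StageFace t (suc s) S
    StageFace-keep st S-omits = stageFace (avoids st)
      (λ k e → proj₁ (new-range st k e) , m<n⇒m<1+n (proj₂ (new-range st k e)))
      (exclusive st) S-omits

    StageFace-next⇒⊈Fₘ : ∀ {t S} → t < D₂ → s < t → StageFace t (suc s) S → ¬ Fₘ ⊆ S
    StageFace-next⇒⊈Fₘ {t} t<D₂ s<t st Fₘ⊆S = avoids st t (old⊑ (⊆⇒⊑ Fₘ⊆S) t (FSet∋old m t s<t t<D₂)) refl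

    StageFace-next-∌vₘ : ∀ {t S} → StageFace t (suc s) S → newBit S s ≡ false → StageFace t s S × Omits (suc s) S
    StageFace-next-∌vₘ {t} {S} st vₘ∉S = stageFace (avoids st) new-range′ (exclusive st) (Omits-weaken (omits st)) , omits st
      where
      new-range′ : ∀ k → S ∋new k → t ≤ k × k < s
      new-range′ k e = proj₁ (new-range st k e) , ≤∧≢⇒< (m<1+n⇒m≤n (proj₂ (new-range st k e))) k≢s
        where
        k≢s : k ≢ s
        k≢s refl = false≢true (trans (sym vₘ∉S) e)

    link : Face d → Face d
    link S = S ─ (Fₘ ∪ vₘ)

    link∩Fₘ≡∅ : ∀ S → link S ∩ Fₘ ≡ ∅
    link∩Fₘ≡∅ S = ─∩-disjoint S (Fₘ ∪ vₘ) Fₘ (p⊆p∪q vₘ)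

    link∌vₘ : ∀ S → ¬ link S ∋new s
    link∌vₘ S e = ∩≡∅⇒∌new (link S) vₘ (─∩-disjoint S (Fₘ ∪ vₘ) vₘ (q⊆p∪q Fₘ vₘ)) s e (⁅new⁆∋new m)

    link⊑ : ∀ S → link S ⊑ S
    link⊑ S = ⊆⇒⊑ (p─q⊆p S (Fₘ ∪ vₘ))

    StageFace-next-∋vₘ⇒link∪Fₘ : ∀ {t S} → StageFace t (suc s) S → S ∋new s → StageFace t s (link S ∪ Fₘ)
    StageFace-next-∋vₘ⇒link∪Fₘ {t} {S} st vₘ∈S = stageFace avoids′ new-range′ exclusive′ (s , ≤-refl , s<D₂ , s∉X)
      where
      C = link S
      X = C ∪ Fₘ
      t≤s = proj₁ (new-range st s vₘ∈S)
      s∉S : oldBit S s ≡ false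
      s∉S = ≢true⇒≡false λ s∈S →
        [ (λ t<s → exclusive st s t<s s∈S vₘ∈S) , (λ t≡s → avoids st s s∈S (sym t≡s)) ]′ (m≤n⇒m<n∨m≡n t≤s)
      C∋new⇒< : ∀ k → C ∋new k → k < s
      C∋new⇒< k e = ≤∧≢⇒< (m<1+n⇒m≤n (proj₂ (new-range st k (new⊑ (link⊑ S) k e)))) (λ { refl → link∌vₘ S e })
      X∋new⇒C : ∀ k → X ∋new k → C ∋new k
      X∋new⇒C k e = [ (λ c → c) , (λ f → ⊥-elim (FSet∌new m k f)) ]′ (∪∋new⁻ C Fₘ k e)
      avoids′ : ∀ k → X ∋old k → k ≢ t
      avoids′ k e =
        [ (λ c → avoids st k (old⊑ (link⊑ S) k c)) , (λ f → >⇒≢ (≤-<-trans t≤s (FSet∋old⇒> m k f))) ]′ (∪∋old⁻ C Fₘ k e)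
      new-range′ : ∀ k → X ∋new k → t ≤ k × k < s
      new-range′ k e = proj₁ (new-range st k (new⊑ (link⊑ S) k (X∋new⇒C k e))) , C∋new⇒< k (X∋new⇒C k e)
      exclusive′ : ∀ k → t < k → X ∋old k → ¬ X ∋new k
      exclusive′ k t<k eo en = [ (λ c → exclusive st k t<k (old⊑ (link⊑ S) k c) (new⊑ (link⊑ S) k (X∋new⇒C k en))) ,
                                 (λ f → <-asym (FSet∋old⇒> m k f) (C∋new⇒< k (X∋new⇒C k en))) ]′ (∪∋old⁻ C Fₘ k eo)
      s∉X : oldBit X s ≡ false
      s∉X = ≢true⇒≡false λ e → [ (λ c → false≢true (trans (sym s∉S) (old⊑ (link⊑ S) s c))) ,
                                  (λ f → false≢true (trans (sym (FSet∌old m)) f)) ]′ (∪∋old⁻ C Fₘ s e)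

    omits-above-Fₘ : ∀ {X} → Fₘ ⊑ X → Omits s X → oldBit X s ≡ false
    omits-above-Fₘ {X} Fₘ⊑X (k , s≤k , k<D₂ , k∉X) with m≤n⇒m<n∨m≡n s≤k
    ... | inj₁ s<k = ⊥-elim (false≢true (trans (sym k∉X) (old⊑ Fₘ⊑X k (FSet∋old m k s<k k<D₂))))
    ... | inj₂ refl = k∉X

    cone⇒StageFace-next : ∀ {t} A B C → A ⊆ vₘ → B ⊆ Fₘ → B ≢ Fₘ → C ∩ Fₘ ≡ ∅ → t < D₂ →
                          StageFace t s (C ∪ Fₘ) → StageFace t (suc s) ((A ∪ B) ∪ C)
    cone⇒StageFace-next {t} A B C A⊆vₘ B⊆Fₘ B≢Fₘ C∩Fₘ≡∅ t<D₂ stX =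
      stageFace (λ k e → avoids stX k (S∋old⇒X k e)) new-range′ exclusive′ omits′
      where
      S = (A ∪ B) ∪ C
      X = C ∪ Fₘ
      Fₘ⊑X : Fₘ ⊑ X
      Fₘ⊑X = ⊆⇒⊑ (q⊆p∪q C Fₘ)
      t≤s : t ≤ s
      t≤s = Fₘ-StageFace⇒≤ t<D₂ (StageFace-⊑ Fₘ⊑X stX)
      S∋old⇒ : ∀ k → S ∋old k → B ∋old k ⊎ C ∋old k
      S∋old⇒ k e with ∪∋old⁻ (A ∪ B) C k e
      ... | inj₂ c = inj₂ c
      ... | inj₁ ab with ∪∋old⁻ A B k ab
      ...   | inj₁ a = ⊥-elim (false≢true (trans (sym (⁅new⁆∌old m k)) (old⊑ (⊆⇒⊑ A⊆vₘ) k a)))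
      ...   | inj₂ b = inj₁ b
      S∋old⇒X : ∀ k → S ∋old k → X ∋old k
      S∋old⇒X k e = [ (λ b → old⊑ Fₘ⊑X k (old⊑ (⊆⇒⊑ B⊆Fₘ) k b)) , old⊑ (⊆⇒⊑ (p⊆p∪q Fₘ)) k ]′ (S∋old⇒ k e)
      S∋new⇒ : ∀ k → S ∋new k → k ≡ s ⊎ X ∋new k
      S∋new⇒ k e with ∪∋new⁻ (A ∪ B) C k e
      ... | inj₂ c = inj₂ (new⊑ (⊆⇒⊑ (p⊆p∪q Fₘ)) k c)
      ... | inj₁ ab with ∪∋new⁻ A B k ab
      ...   | inj₁ a = inj₁ (⁅new⁆∋new⇒≡ m k (new⊑ (⊆⇒⊑ A⊆vₘ) k a))
      ...   | inj₂ b = ⊥-elim (FSet∌new m k (new⊑ (⊆⇒⊑ B⊆Fₘ) k b))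
      new-range′ : ∀ k → S ∋new k → t ≤ k × k < suc s
      new-range′ k e with S∋new⇒ k e
      ... | inj₁ refl = t≤s , ≤-refl
      ... | inj₂ x = proj₁ (new-range stX k x) , m<n⇒m<1+n (proj₂ (new-range stX k x))
      exclusive′ : ∀ k → t < k → S ∋old k → ¬ S ∋new k
      exclusive′ k t<k eo en with S∋new⇒ k en
      ... | inj₁ refl = false≢true (trans (sym (omits-above-Fₘ Fₘ⊑X (omits stX))) (S∋old⇒X k eo))
      ... | inj₂ x = exclusive stX k t<k (S∋old⇒X k eo) x
      omits′ : Omits (suc s) S
      omits′ with ⊈Fₘ⇒omits B (λ Fₘ⊆B → B≢Fₘ (⊆-antisym B⊆Fₘ Fₘ⊆B))
      ... | k , s<k , k<D₂ , k∉B = k , s<k , k<D₂ , ≢true⇒≡false k∉S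
        where
        k∈Fₘ = FSet∋old m k s<k k<D₂
        k∉S : ¬ S ∋old k
        k∉S e = [ (λ b → false≢true (trans (sym k∉B) b)) , (λ c → ∩≡∅⇒∌old C Fₘ C∩Fₘ≡∅ k c k∈Fₘ) ]′
                  (S∋old⇒ k e)

    StellarSub⇔StageFaceOf : ∀ {K : Complex d} {is} → (∀ S → K S ⇔ StageFaceOf s is S) →
                             ∀ S → StellarSub K Fₘ (new m) S ⇔ StageFaceOf (suc s) is S
    StellarSub⇔StageFaceOf {K} {is} K⇔ S = mk⇔ forward backward
      where
      forward : StellarSub K Fₘ (new m) S → StageFaceOf (suc s) is S
      forward (inj₁ (S∈K , Fₘ⊈S)) with find (to (K⇔ S) S∈K)
      ... | i , i∈is , st with toℕ i ≤? s
      ...   | yes _ = lose i∈is (StageFace-keep st (⊈Fₘ⇒omits S Fₘ⊈S))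
      ...   | no t≰s = lose i∈is (to (StageFace-skip (toℕ<n i) (≰⇒> t≰s)) st)
      forward (inj₂ (A , B , C , A⊆vₘ , (B⊆Fₘ , B≢Fₘ) , (_ , C∩Fₘ≡∅ , C∪Fₘ∈K) , S≡))
        with find (to (K⇔ (C ∪ Fₘ)) C∪Fₘ∈K)
      ... | i , i∈is , st =
        subst (StageFaceOf (suc s) is) (sym S≡) (lose i∈is (cone⇒StageFace-next A B C A⊆vₘ B⊆Fₘ B≢Fₘ C∩Fₘ≡∅ (toℕ<n i) st))
      backward : StageFaceOf (suc s) is S → StellarSub K Fₘ (new m) S
      backward S∈ with find S∈
      ... | i , i∈is , st with toℕ i ≤? s
      ...   | no t≰s = inj₁ (from (K⇔ S) (lose i∈is (from (StageFace-skip (toℕ<n i) (≰⇒> t≰s)) st)) ,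
                             StageFace-next⇒⊈Fₘ (toℕ<n i) (≰⇒> t≰s) st)
      ...   | yes _ with ≡true? (newBit S s)
      ...     | no vₘ∉S = let st′ , S-omits = StageFace-next-∌vₘ st (≢true⇒≡false vₘ∉S) in
                          inj₁ (from (K⇔ S) (lose i∈is st′) , omits⇒⊈Fₘ S S-omits)
      ...     | yes vₘ∈S = inj₂ (vₘ , S ∩ Fₘ , link S , (λ x∈ → x∈) , (p∩q⊆q S Fₘ , S∩Fₘ≢Fₘ) ,
                                 (link∈K , link∩Fₘ≡∅ S , from (K⇔ _) (lose i∈is stX)) ,
                                 ∈⇒≡cone-split S Fₘ (∋new⇒∈ S m vₘ∈S))
        where
        stX = StageFace-next-∋vₘ⇒link∪Fₘ st vₘ∈S
        link∈K = from (K⇔ (link S)) (lose i∈is (StageFace-⊑ (⊆⇒⊑ (p⊆p∪q Fₘ)) stX))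
        S∩Fₘ≢Fₘ : S ∩ Fₘ ≢ Fₘ
        S∩Fₘ≢Fₘ eq = omits⇒⊈Fₘ S (omits st) (subst (_⊆ S) eq (p∩q⊆p S Fₘ))

    Fₘ∈K⇔ : ∀ {K : Complex d} {is} → (∀ S → K S ⇔ StageFaceOf s is S) → K Fₘ ⇔ Any (λ i → toℕ i ≤ s) is
    Fₘ∈K⇔ K⇔ = mk⇔
      (λ Fₘ∈K → let i , i∈is , st = find (to (K⇔ Fₘ) Fₘ∈K) in lose i∈is (Fₘ-StageFace⇒≤ (toℕ<n i) st))
      (λ acts → let i , i∈is , t≤s = find acts in from (K⇔ Fₘ) (lose i∈is (Fₘ-StageFace t≤s)))

    StageFaceOf-skip : ∀ {is} → ¬ Any (λ i → toℕ i ≤ s) is → ∀ S → StageFaceOf s is S ⇔ StageFaceOf (suc s) is S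
    StageFaceOf-skip inert S = mk⇔
      (λ S∈ → let i , i∈is , st = find S∈ in lose i∈is (to (StageFace-skip (toℕ<n i) (s<t i∈is)) st))
      (λ S∈ → let i , i∈is , st = find S∈ in lose i∈is (from (StageFace-skip (toℕ<n i) (s<t i∈is)) st))
      where
      s<t : ∀ {i} → i ∈ₗ _ → s < toℕ i
      s<t {i} i∈is = ≰⇒> (λ t≤s → inert (lose i∈is t≤s))

    DiamondStep⇔StageFaceOf : ∀ {K : Complex d} {is} → (∀ S → K S ⇔ StageFaceOf s is S) →
                              ∀ S → DiamondStep K m S ⇔ StageFaceOf (suc s) is S
    DiamondStep⇔StageFaceOf {K} {is} K⇔ S with any? (λ i → toℕ i ≤? s) is
    ... | yes acts = mk⇔
      (λ { (inj₁ (_ , S∈sub)) → to (StellarSub⇔StageFaceOf K⇔ S) S∈sub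
         ; (inj₂ (Fₘ∉K , _)) → ⊥-elim (Fₘ∉K (from (Fₘ∈K⇔ K⇔) acts)) })
      (λ S∈ → inj₁ (from (Fₘ∈K⇔ K⇔) acts , from (StellarSub⇔StageFaceOf K⇔ S) S∈))
    ... | no inert = mk⇔
      (λ { (inj₁ (Fₘ∈K , _)) → ⊥-elim (inert (to (Fₘ∈K⇔ K⇔) Fₘ∈K))
         ; (inj₂ (_ , S∈K)) → to (StageFaceOf-skip inert S) (to (K⇔ S) S∈K) })
      (λ S∈ → inj₂ ((λ Fₘ∈K → inert (to (Fₘ∈K⇔ K⇔) Fₘ∈K)) , from (K⇔ S) (from (StageFaceOf-skip inert S) S∈)))

  DiamondSteps⇔StageFaceOf : ∀ {is} n k (f : Fin n → Fin D₁) → (∀ j → toℕ (f j) ≡ k + toℕ j) → ∀ {K : Complex d} →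
                             (∀ S → K S ⇔ StageFaceOf k is S) → ∀ S → foldl DiamondStep K (List.tabulate f) S ⇔ StageFaceOf (k + n) is S
  DiamondSteps⇔StageFaceOf {is} zero k f _ {K} K⇔ S = subst (λ m → K S ⇔ StageFaceOf m is S) (sym (+-identityʳ k)) (K⇔ S)
  DiamondSteps⇔StageFaceOf {is} (suc n) k f f≡ {K} K⇔ S =
    subst (λ m → foldl DiamondStep K (List.tabulate f) S ⇔ StageFaceOf m is S) (sym (+-suc k n))
      (DiamondSteps⇔StageFaceOf n (suc k) (λ j → f (Fin.suc j)) (λ j → trans (f≡ (Fin.suc j)) (+-suc k (toℕ j))) step⇔ S)
    where
    s≡k : toℕ (f Fin.zero) ≡ k
    s≡k = trans (f≡ Fin.zero) (+-identityʳ k)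
    step⇔ : ∀ S → DiamondStep K (f Fin.zero) S ⇔ StageFaceOf (suc k) is S
    step⇔ S = subst (λ m → DiamondStep K (f Fin.zero) S ⇔ StageFaceOf (suc m) is S) s≡k
                (Step.DiamondStep⇔StageFaceOf (f Fin.zero) (λ S → subst (λ m → K S ⇔ StageFaceOf m is S) (sym s≡k) (K⇔ S)) S)

  Diamond⇔StageFaceOf : ∀ is S → Diamond (GenCx is) S ⇔ StageFaceOf D₁ is S
  Diamond⇔StageFaceOf is = DiamondSteps⇔StageFaceOf D₁ 0 (λ j → j) (λ _ → refl) GenCx⇔
    where
    GenCx⇔ : ∀ S → GenCx is S ⇔ StageFaceOf 0 is S
    GenCx⇔ S = mk⇔ (Any.map (λ {i} → to (⊆ΓSet⇔StageFace₀ i S))) (Any.map (λ {i} → from (⊆ΓSet⇔StageFace₀ i S)))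

module ModelFacets (d : ℕ) where
  open Coordinates d
  open NamedFaces d
  open Stages d

  -- The facets of ◇(Γ_t) are {0,…,t-1, v_t} ∪ F' with F' containing one of j, v_j for every t < j ≤ d.
  record FacetSlot (t n : ℕ) (o b : Bool) : Set where
    field
      below : n < t → o ≡ true × b ≡ false
      at    : n ≡ t → o ≡ false × (n < D₁ → b ≡ true)
      above : t < n → n < D₁ → OneOf o b
      top   : D₁ ≤ n → o ≡ false
  open FacetSlot public

  ModelFacet : ℕ → Face d → Set
  ModelFacet t H = ∀ n → FacetSlot t n (oldBit H n) (newBit H n)

  StageFace-∌top : ∀ {t S} → StageFace t D₁ S → oldBit S D₁ ≡ false
  StageFace-∌top st with omits st
  ... | k , D₁≤k , k<D₂ , k∉S = subst (λ k → oldBit _ k ≡ false) (≤-antisym (m<1+n⇒m≤n k<D₂) D₁≤k) k∉S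

  ModelFacet⇒StageFace : ∀ {t H} → ModelFacet t H → StageFace t D₁ H
  ModelFacet⇒StageFace {t} {H} H-facet = stageFace
    (λ k e k≡t → false≢true (trans (sym (proj₁ (at (H-facet k) k≡t))) e))
    (λ k e → t≤ k e , ∋new⇒< H k e)
    (λ k t<k eo en → [ (λ (_ , b) → false≢true (trans (sym b) en)) , (λ (o , _) → false≢true (trans (sym o) eo)) ]′
                       (above (H-facet k) t<k (∋new⇒< H k en)))
    (D₁ , ≤-refl , ≤-refl , top (H-facet D₁) ≤-refl)
    where
    t≤ : ∀ k → H ∋new k → t ≤ k
    t≤ k e with t ≤? k
    ... | yes t≤k = t≤k
    ... | no t≰k = ⊥-elim (false≢true (trans (sym (proj₂ (below (H-facet k) (≰⇒> t≰k)))) e))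

  ModelFacet-StageFace-index : ∀ {t t′ H S} → ModelFacet t H → H ⊑ S → t′ < D₂ → StageFace t′ D₁ S → t′ ≡ t
  ModelFacet-StageFace-index {t} {t′} H-facet H⊑S t′<D₂ st with <-cmp t′ t
  ... | tri< t′<t _ _ = ⊥-elim (avoids st t′ (old⊑ H⊑S t′ (proj₁ (below (H-facet t′) t′<t))) refl)
  ... | tri≈ _ t′≡t _ = t′≡t
  ... | tri> _ _ t<t′ = ⊥-elim (<⇒≱ t<t′ (proj₁ (new-range st t (new⊑ H⊑S t (proj₂ (at (H-facet t) refl) t<D₁)))))
    where t<D₁ = <-≤-trans t<t′ (m<1+n⇒m≤n t′<D₂)

  ModelFacet-maximal : ∀ {t H S} → ModelFacet t H → H ⊑ S → StageFace t D₁ S → S ≡ H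
  ModelFacet-maximal {t} {H} {S} H-facet H⊑S st = ⊑-antisym (oldS⇒oldH , newS⇒newH) H⊑S
    where
    oldS⇒oldH : ∀ k → S ∋old k → H ∋old k
    oldS⇒oldH k e with <-cmp k t | k <? D₁
    ... | tri< k<t _ _ | _ = proj₁ (below (H-facet k) k<t)
    ... | tri≈ _ k≡t _ | _ = ⊥-elim (avoids st k e k≡t)
    ... | tri> _ _ t<k | no k≮D₁ = ⊥-elim (false≢true (trans (sym (StageFace-∌top st))
                                      (subst (S ∋old_) (≤-antisym (m<1+n⇒m≤n (∋old⇒< S k e)) (≮⇒≥ k≮D₁)) e)))
    ... | tri> _ _ t<k | yes k<D₁ =
      [ proj₁ , (λ (_ , k∈H) → ⊥-elim (exclusive st k t<k e (new⊑ H⊑S k k∈H))) ]′ (above (H-facet k) t<k k<D₁)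
    newS⇒newH : ∀ k → S ∋new k → H ∋new k
    newS⇒newH k e with new-range st k e
    ... | t≤k , k<D₁ with m≤n⇒m<n∨m≡n t≤k
    ...   | inj₂ refl = proj₂ (at (H-facet k) refl) k<D₁
    ...   | inj₁ t<k =
      [ (λ (k∈H , _) → ⊥-elim (exclusive st k t<k (old⊑ H⊑S k k∈H) e)) , proj₂ ]′ (above (H-facet k) t<k k<D₁)

  -- Fill S up to a facet: add every old vertex below t, and v_n wherever t ≤ n and S lacks n.
  StageFace⇒⊑ModelFacet : ∀ {t S} → t < D₂ → StageFace t D₁ S → Σ (Face d) λ H → ModelFacet t H × S ⊑ H
  StageFace⇒⊑ModelFacet {t} {S} t<D₂ st = H , H-facet , (S∋old⇒H , S∋new⇒H)
    where
    o b : ℕ → Bool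
    o n = oldBit S n ∨ (n <ᵇ t)
    b n = newBit S n ∨ ((t ≤ᵇ n) ∧ not (oldBit S n))
    H = fromBits o b
    S∋old⇒H : ∀ n → S ∋old n → H ∋old n
    S∋old⇒H n e = trans (oldBit-fromBits o b n (∋old⇒< S n e)) (∨≡trueˡ e)
    S∋new⇒H : ∀ n → S ∋new n → H ∋new n
    S∋new⇒H n e = trans (newBit-fromBits o b n (∋new⇒< S n e)) (∨≡trueˡ e)
    t∉S : oldBit S t ≡ false
    t∉S = ≢true⇒≡false (λ e → avoids st t e refl)
    S∌new-below : ∀ n → n < t → newBit S n ≡ false
    S∌new-below n n<t = ≢true⇒≡false (λ e → <⇒≱ n<t (proj₁ (new-range st n e)))
    H-facet : ModelFacet t H
    below (H-facet n) n<t = trans (oldBit-fromBits o b n (<-trans n<t t<D₂)) (∨≡trueʳ (<ᵇ≡true n<t)) , H∌new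
      where
      H∌new : newBit H n ≡ false
      H∌new = [ (λ n<D₁ → trans (newBit-fromBits o b n n<D₁)
                                (cong₂ (λ x y → x ∨ (y ∧ not (oldBit S n))) (S∌new-below n n<t) (≤ᵇ≡false (<⇒≱ n<t)))) ,
                (λ D₁≤n → newBit-≥ H n D₁≤n) ]′ (<-≤-connex n D₁)
    at (H-facet n) refl = H∌old-t , H∋new-t
      where
      H∌old-t : oldBit H t ≡ false
      H∌old-t rewrite oldBit-fromBits o b t t<D₂ | t∉S | <ᵇ≡false (<-irrefl {t} refl) = refl
      H∋new-t : t < D₁ → H ∋new t
      H∋new-t t<D₁ rewrite newBit-fromBits o b t t<D₁ | t∉S | ≤ᵇ≡true (≤-refl {t}) = ∨-zeroʳ (newBit S t)
    above (H-facet n) t<n n<D₁ with ≡true? (oldBit S n)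
    ... | yes n∈S = inj₁ (trans (oldBit-fromBits o b n (m<n⇒m<1+n n<D₁)) (∨≡trueˡ n∈S) , H∌new)
      where
      H∌new : newBit H n ≡ false
      H∌new rewrite newBit-fromBits o b n n<D₁ | ≢true⇒≡false (exclusive st n t<n n∈S) | n∈S = ∧-zeroʳ (t ≤ᵇ n)
    ... | no n∉S = inj₂ (H∌old , H∋new)
      where
      H∌old : oldBit H n ≡ false
      H∌old rewrite oldBit-fromBits o b n (m<n⇒m<1+n n<D₁) | ≢true⇒≡false n∉S | <ᵇ≡false (<-asym t<n) = refl
      H∋new : H ∋new n
      H∋new rewrite newBit-fromBits o b n n<D₁ | ≢true⇒≡false n∉S | ≤ᵇ≡true (<⇒≤ t<n) = ∨-zeroʳ (newBit S n)
    top (H-facet n) D₁≤n = [ (λ n<D₂ → subst (λ k → oldBit H k ≡ false) (≤-antisym D₁≤n (m<1+n⇒m≤n n<D₂)) H∌old-top) ,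
                             oldBit-≥ H n ]′ (<-≤-connex n D₂)
      where
      H∌old-top : oldBit H D₁ ≡ false
      H∌old-top = trans (oldBit-fromBits o b D₁ ≤-refl) (cong₂ _∨_ (StageFace-∌top st) (<ᵇ≡false (≤⇒≯ (m<1+n⇒m≤n t<D₂))))

  ModelFacet⇒∣∣≡D₁ : ∀ {t H} → ModelFacet t H → ∣ H ∣ ≡ D₁
  ModelFacet⇒∣∣≡D₁ {t} {H} H-facet = begin
    ∣ H ∣                                                ≡⟨ cong ∣_∣ (sym (fromBits-bits H)) ⟩
    ∣ fromBits (oldBit H) (newBit H) ∣                   ≡⟨ ∣fromBits∣ (oldBit H) (newBit H) ⟩
    countBits (oldBit H) D₂ + countBits (newBit H) D₁    ≡⟨ cong (_+ countBits (newBit H) D₁) old-count ⟩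
    countBits (oldBit H) D₁ + countBits (newBit H) D₁    ≡⟨ countBits-complementary (oldBit H) (newBit H) D₁ one-per-slot ⟩
    D₁                                                   ∎
    where
    open ≡-Reasoning
    old-count : countBits (oldBit H) D₂ ≡ countBits (oldBit H) D₁
    old-count = trans (countBits-snoc (oldBit H) D₁)
                      (trans (cong (λ x → countBits (oldBit H) D₁ + oneIf x) (top (H-facet D₁) ≤-refl)) (+-identityʳ _))
    one-per-slot : ∀ k → k < D₁ → oneIf (oldBit H k) + oneIf (newBit H k) ≡ 1
    one-per-slot k k<D₁ with <-cmp k t
    ... | tri< k<t _ _ = oneIf-exactly-one (inj₁ (below (H-facet k) k<t))
    ... | tri≈ _ k≡t _ = oneIf-exactly-one (inj₂ (proj₁ (at (H-facet k) k≡t) , proj₂ (at (H-facet k) k≡t) k<D₁))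
    ... | tri> _ _ t<k = oneIf-exactly-one (above (H-facet k) t<k k<D₁)

  IsFacet-Diamond⇔ModelFacet : ∀ is H → IsFacet (Diamond (GenCx is)) H ⇔ Any (λ i → ModelFacet (toℕ i) H) is
  IsFacet-Diamond⇔ModelFacet is H = mk⇔ forward backward
    where
    forward : IsFacet (Diamond (GenCx is)) H → Any (λ i → ModelFacet (toℕ i) H) is
    forward (H∈K , H-maximal) with find (to (Diamond⇔StageFaceOf is H) H∈K)
    ... | i , i∈is , st with StageFace⇒⊑ModelFacet (toℕ<n i) st
    ...   | H′ , H′-facet , H⊑H′ = lose i∈is (subst (ModelFacet (toℕ i)) H′≡H H′-facet)
      where
      H′≡H = H-maximal H′ (from (Diamond⇔StageFaceOf is H′) (lose i∈is (ModelFacet⇒StageFace H′-facet))) (⊑⇒⊆ H⊑H′)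
    backward : Any (λ i → ModelFacet (toℕ i) H) is → IsFacet (Diamond (GenCx is)) H
    backward H-facet with find H-facet
    ... | i , i∈is , H-facetᵢ = from (Diamond⇔StageFaceOf is H) (lose i∈is (ModelFacet⇒StageFace H-facetᵢ)) , H-maximal
      where
      H-maximal : ∀ S → Diamond (GenCx is) S → H ⊆ S → S ≡ H
      H-maximal S S∈K H⊆S with find (to (Diamond⇔StageFaceOf is S) S∈K)
      ... | i′ , _ , st = ModelFacet-maximal H-facetᵢ (⊆⇒⊑ H⊆S)
                            (subst (λ t → StageFace t D₁ S) (ModelFacet-StageFace-index H-facetᵢ (⊆⇒⊑ H⊆S) (toℕ<n i′) st) st)

  IsFacet-Diamond⇔ModelFacet-single : ∀ i H → IsFacet (Diamond (GenCx (i ∷ []))) H ⇔ ModelFacet (toℕ i) H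
  IsFacet-Diamond⇔ModelFacet-single i H = mk⇔
    (λ H-facet → case to (IsFacet-Diamond⇔ModelFacet (i ∷ []) H) H-facet of λ { (here H-facetᵢ) → H-facetᵢ })
    (λ H-facetᵢ → from (IsFacet-Diamond⇔ModelFacet (i ∷ []) H) (here H-facetᵢ))

  Diamond-pure : ∀ is → Pure (Diamond (GenCx is))
  Diamond-pure is H H′ H-facet H′-facet with find (to (IsFacet-Diamond⇔ModelFacet is H) H-facet)
                                           | find (to (IsFacet-Diamond⇔ModelFacet is H′) H′-facet)
  ... | _ , _ , H-model | _ , _ , H′-model = trans (ModelFacet⇒∣∣≡D₁ H-model) (sym (ModelFacet⇒∣∣≡D₁ H′-model))

module SlotUpdates (d : ℕ) where
  open Coordinates d
  open ModelFacets d

  module _ (H : Face d) (k : ℕ) (o b : Bool) where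
    private
      oldBits newBits : ℕ → Bool
      oldBits n = if n ≡ᵇ k then o else oldBit H n
      newBits n = if n ≡ᵇ k then b else newBit H n

    setSlot : Face d
    setSlot = fromBits oldBits newBits

    oldBit-setSlot-≢ : ∀ n → n ≢ k → oldBit setSlot n ≡ oldBit H n
    oldBit-setSlot-≢ n n≢k = oldBit≡-from-range setSlot H n λ n<D₂ →
      trans (oldBit-fromBits oldBits newBits n n<D₂) (cong (λ c → if c then o else oldBit H n) (≡ᵇ≡false n≢k))

    newBit-setSlot-≢ : ∀ n → n ≢ k → newBit setSlot n ≡ newBit H n
    newBit-setSlot-≢ n n≢k = newBit≡-from-range setSlot H n λ n<D₁ →
      trans (newBit-fromBits oldBits newBits n n<D₁) (cong (λ c → if c then b else newBit H n) (≡ᵇ≡false n≢k))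

    oldBit-setSlot-≡ : k < D₂ → oldBit setSlot k ≡ o
    oldBit-setSlot-≡ k<D₂ = trans (oldBit-fromBits oldBits newBits k k<D₂) (cong (λ c → if c then o else oldBit H k) (≡ᵇ≡true k))

    newBit-setSlot-≡ : k < D₁ → newBit setSlot k ≡ b
    newBit-setSlot-≡ k<D₁ = trans (newBit-fromBits oldBits newBits k k<D₁) (cong (λ c → if c then b else newBit H k) (≡ᵇ≡true k))

    ModelFacet-setSlot : ∀ {t} → k < D₁ → (∀ n → n ≢ k → FacetSlot t n (oldBit H n) (newBit H n)) →
                         FacetSlot t k o b → ModelFacet t setSlot
    ModelFacet-setSlot {t} k<D₁ elsewhere slot n with n ≟ k
    ... | yes refl = subst₂ (FacetSlot t n) (sym (oldBit-setSlot-≡ (m<n⇒m<1+n k<D₁))) (sym (newBit-setSlot-≡ k<D₁)) slot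
    ... | no n≢k = subst₂ (FacetSlot t n) (sym (oldBit-setSlot-≢ n n≢k)) (sym (newBit-setSlot-≢ n n≢k)) (elsewhere n n≢k)

  FacetSlot-lower : ∀ {t t′ n o b} → t′ < t → n ≢ t′ → FacetSlot t n o b → FacetSlot t′ n o b
  below (FacetSlot-lower t′<t _ slot) n<t′ = below slot (<-trans n<t′ t′<t)
  at (FacetSlot-lower _ n≢t′ _) n≡t′ = ⊥-elim (n≢t′ n≡t′)
  above (FacetSlot-lower {t} {n = n} _ _ slot) t′<n n<D₁ with <-cmp n t
  ... | tri< n<t _ _ = inj₁ (below slot n<t)
  ... | tri≈ _ n≡t _ = inj₂ (proj₁ (at slot n≡t) , proj₂ (at slot n≡t) n<D₁)
  ... | tri> _ _ t<n = above slot t<n n<D₁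
  top (FacetSlot-lower _ _ slot) = top slot

  ModelFacet-swap : ∀ {t H k o b} → ModelFacet t H → t < k → k < D₁ → OneOf o b → ModelFacet t (setSlot H k o b)
  ModelFacet-swap {t} {H} {k} {o} {b} H-facet t<k k<D₁ o-or-b = ModelFacet-setSlot H k o b k<D₁ (λ n _ → H-facet n) slot
    where
    slot : FacetSlot t k o b
    slot = record { below = λ k<t → ⊥-elim (<-asym k<t t<k) ; at = λ k≡t → ⊥-elim (>⇒≢ t<k k≡t)
                  ; above = λ _ _ → o-or-b ; top = λ D₁≤k → ⊥-elim (<⇒≱ k<D₁ D₁≤k) }

  ⊑-setSlot : ∀ {S H k o b} → S ⊑ H → k < D₁ → (S ∋old k → o ≡ true) → (S ∋new k → b ≡ true) → S ⊑ setSlot H k o b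
  ⊑-setSlot {S} {H} {k} {o} {b} S⊑H k<D₁ old⇒o new⇒b = old-part , new-part
    where
    old-part : ∀ n → S ∋old n → setSlot H k o b ∋old n
    old-part n e with n ≟ k
    ... | yes refl = trans (oldBit-setSlot-≡ H k o b (m<n⇒m<1+n k<D₁)) (old⇒o e)
    ... | no n≢k = trans (oldBit-setSlot-≢ H k o b n n≢k) (old⊑ S⊑H n e)
    new-part : ∀ n → S ∋new n → setSlot H k o b ∋new n
    new-part n e with n ≟ k
    ... | yes refl = trans (newBit-setSlot-≡ H k o b k<D₁) (new⇒b e)
    ... | no n≢k = trans (newBit-setSlot-≢ H k o b n n≢k) (new⊑ S⊑H n e)

  ModelFacet-lower : ∀ {t t′ H} → ModelFacet t H → t′ < t → t < D₂ → ModelFacet t′ (setSlot H t′ false true)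
  ModelFacet-lower {t} {t′} {H} H-facet t′<t t<D₂ =
    ModelFacet-setSlot H t′ false true t′<D₁ (λ n n≢t′ → FacetSlot-lower t′<t n≢t′ (H-facet n)) slot
    where
    t′<D₁ = <-≤-trans t′<t (m<1+n⇒m≤n t<D₂)
    slot : FacetSlot t′ t′ false true
    slot = record { below = λ t′<t′ → ⊥-elim (<-irrefl refl t′<t′) ; at = λ _ → refl , (λ _ → refl)
                  ; above = λ t′<t′ → ⊥-elim (<-irrefl refl t′<t′) ; top = λ D₁≤t′ → ⊥-elim (<⇒≱ t′<D₁ D₁≤t′) }

  ModelFacet-distinct : ∀ {t t′ G H} → ModelFacet t′ G → ModelFacet t H → t′ < t → G ≢ H
  ModelFacet-distinct {t′ = t′} G-facet H-facet t′<t refl =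
    false≢true (trans (sym (proj₁ (at (G-facet t′) refl))) (proj₁ (below (H-facet t′) t′<t)))

module DegreeLex (d : ℕ) where
  open Coordinates d
  open SlotUpdates d

  differs : Face d → Face d → ℕ → Bool
  differs F H k = slotDiffers (oldBit H k) (newBit H k) (oldBit F k) (newBit F k)

  φ≡map-differs : ∀ (i : Fin D₂) F H →
                  φ i F H ≡ List.map (λ j → differs F H (toℕ j)) (List.filter (λ j → toℕ i <? toℕ j) (List.allFin D₁))
  φ≡map-differs i F H = List.map-cong (λ j → cong₂ (λ x y → not (x ∨ y))
    (cong₂ _∧_ (oldBit-inject₁ H j) (oldBit-inject₁ F j)) (cong₂ _∧_ (newBit-lookup H j) (newBit-lookup F j))) _
    where
    oldBit-inject₁ : ∀ S j → lookup S (old (inject₁ j)) ≡ oldBit S (toℕ j)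
    oldBit-inject₁ S j = trans (oldBit-lookup S (inject₁ j)) (cong (oldBit S) (toℕ-inject₁ j))

  differs⇒φ-≽ : ∀ (i : Fin D₂) F G H → (∀ k → toℕ i < k → k < D₁ → differs F H k ≡ true → differs F G k ≡ true) →
                φ i F G ≽ φ i F H
  differs⇒φ-≽ i F G H H⇒G rewrite φ≡map-differs i F G | φ≡map-differs i F H =
    map-≽ _ _ (All.map (λ {j} i<j → H⇒G (toℕ j) i<j (toℕ<n j)) (All.all-filter (λ j → toℕ i <? toℕ j) (List.allFin D₁)))

  φ-≽⇒¬DegLexLt : ∀ (i : Fin D₂) F G H → φ i F G ≽ φ i F H → ¬ DegLexLt i F G H
  φ-≽⇒¬DegLexLt i F G H G≽H (inj₁ deg<) = <⇒≱ deg< (≽⇒deg≤ G≽H)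
  φ-≽⇒¬DegLexLt i F G H G≽H (inj₂ (_ , lex<)) = ≽⇒¬LexLt G≽H lex<

  DegLexLt-irrefl : ∀ (i : Fin D₂) F H → ¬ DegLexLt i F H H
  DegLexLt-irrefl i F H = φ-≽⇒¬DegLexLt i F H H ≽-refl


  differs-setSlot-≢ : ∀ F H n o b k → k ≢ n → differs F (setSlot H n o b) k ≡ differs F H k
  differs-setSlot-≢ F H n o b k k≢n =
    cong₂ (λ x y → not ((x ∧ oldBit F k) ∨ (y ∧ newBit F k))) (oldBit-setSlot-≢ H n o b k k≢n) (newBit-setSlot-≢ H n o b k k≢n)

  φ-≽-setSlot-as-F : ∀ (i : Fin D₂) F H n → n < D₁ → OneOf (oldBit F n) (newBit F n) →
                     φ i F H ≽ φ i F (setSlot H n (oldBit F n) (newBit F n))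
  φ-≽-setSlot-as-F i F H n n<D₁ F-slot = differs⇒φ-≽ i F H G G⇒H
    where
    G = setSlot H n (oldBit F n) (newBit F n)
    agrees : differs F G n ≡ false
    agrees = trans (cong₂ (λ x y → not ((x ∧ oldBit F n) ∨ (y ∧ newBit F n)))
                          (oldBit-setSlot-≡ H n (oldBit F n) (newBit F n) (m<n⇒m<1+n n<D₁))
                          (newBit-setSlot-≡ H n (oldBit F n) (newBit F n) n<D₁))
                   (OneOf⇒¬slotDiffers F-slot)
    G⇒H : ∀ k → toℕ i < k → k < D₁ → differs F G k ≡ true → differs F H k ≡ true
    G⇒H k _ _ e with k ≟ n
    ... | yes refl = ⊥-elim (false≢true (trans (sym agrees) e))
    ... | no k≢n = trans (sym (differs-setSlot-≢ F H n _ _ k k≢n)) e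

module Shellings (d : ℕ) where
  ExtendsShelling : List (Face d) → List (Face d) → Set
  ExtendsShelling E Hs = ∀ pre H post → Hs ≡ pre ++ H ∷ post → HasUniqueMinimal (E ++ pre) H

  ExtendsShelling-[] : ∀ E → ExtendsShelling E []
  ExtendsShelling-[] E [] H post ()
  ExtendsShelling-[] E (_ ∷ _) H post ()

  ExtendsShelling-++ : ∀ E xs ys → ExtendsShelling E xs → ExtendsShelling (E ++ xs) ys → ExtendsShelling E (xs ++ ys)
  ExtendsShelling-++ E xs ys xs-ext ys-ext pre H post eq with ++-≡-∷-split xs ys pre H post eq
  ... | inj₁ (pre′ , refl , ys≡) = subst (λ E′ → HasUniqueMinimal E′ H) (List.++-assoc E xs pre′) (ys-ext pre′ H post ys≡)
  ... | inj₂ (post′ , xs≡) = xs-ext pre H post′ xs≡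

  ExtendsShelling⇒unique-minimal : ∀ Hs → ExtendsShelling [] Hs →
                                   ∀ (p : Fin (List.length Hs)) → HasUniqueMinimal (List.take (toℕ p) Hs) (List.lookup Hs p)
  ExtendsShelling⇒unique-minimal Hs ext p = ext _ _ _ (≡take++lookup∷drop Hs p)

  least-new⇒HasUniqueMinimal : ∀ {E : List (Face d)} {H} R → NewFace E H R → (∀ S → NewFace E H S → R ⊆ S) → HasUniqueMinimal E H
  least-new⇒HasUniqueMinimal R R-new R-least =
    R , (R-new , λ S S-new S⊆R → ⊆-antisym S⊆R (R-least S S-new)) ,
    λ M ((M-new , M-minimal)) → sym (M-minimal R R-new (R-least M M-new))

module BlockShelling (d : ℕ) where
  open Coordinates d
  open ModelFacets d
  open SlotUpdates d
  open DegreeLex d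
  open Shellings d

  record Block (i : Fin D₂) (F : Face d) (L : List (Face d)) : Set where
    field
      initial    : ModelFacet (toℕ i) F
      members    : All (ModelFacet (toℕ i)) L
      exhaustive : ∀ G → ModelFacet (toℕ i) G → G ∈ₗ L
      sorted     : AllPairs (DegLexLt i F) L

  record Enumerates (is : List (Fin D₂)) (Hs : List (Face d)) : Set where
    field
      covers : ∀ {i} → i ∈ₗ is → ∀ G → ModelFacet (toℕ i) G → G ∈ₗ Hs
      sound  : All (λ G → Any (λ i → ModelFacet (toℕ i) G) is) Hs

  module Position {i F L} (block : Block i F L) {prev} (prev<i : All (λ i′ → toℕ i′ < toℕ i) prev)
                  {E} (earlier : Enumerates prev E) pre H post (L≡ : L ≡ pre ++ H ∷ post) where
    open Block block
    open Enumerates earlier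

    t : ℕ
    t = toℕ i

    ∈L : ∀ {G} → G ∈ₗ pre ++ H ∷ post → G ∈ₗ L
    ∈L = subst (_ ∈ₗ_) (sym L≡)

    F-facet : ModelFacet t F
    F-facet = initial

    H-facet : ModelFacet t H
    H-facet = All.lookup members (∈L (List.∈-++⁺ʳ pre (here refl)))

    around-H : All (λ G → DegLexLt i F G H) pre × All (DegLexLt i F H) post
    around-H = AllPairs-around pre H post (subst (AllPairs (DegLexLt i F)) L≡ sorted)

    φ-≽⇒∈pre : ∀ G → ModelFacet t G → G ≢ H → φ i F H ≽ φ i F G → G ∈ₗ pre
    φ-≽⇒∈pre G G-facet G≢H H≽G with List.∈-++⁻ pre (subst (G ∈ₗ_) L≡ (exhaustive G G-facet))
    ... | inj₁ G∈pre = G∈pre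
    ... | inj₂ (here G≡H) = ⊥-elim (G≢H G≡H)
    ... | inj₂ (there G∈post) = ⊥-elim (φ-≽⇒¬DegLexLt i F H G H≽G (All.lookup (proj₂ around-H) G∈post))

    isPrev : ℕ → Bool
    isPrev n = any (λ i′ → toℕ i′ ≡ᵇ n) prev

    isPrev⁻ : ∀ n → isPrev n ≡ true → Σ (Fin D₂) λ i′ → i′ ∈ₗ prev × toℕ i′ ≡ n
    isPrev⁻ n e = let i′ , i′∈prev , i′≡n = find (any⁻ _ prev (from T-≡ e)) in
                  i′ , i′∈prev , ≡ᵇ≡true⁻ (to T-≡ i′≡n)

    isPrev⁺ : ∀ {i′} → i′ ∈ₗ prev → isPrev (toℕ i′) ≡ true
    isPrev⁺ {i′} i′∈prev = to T-≡ (any⁺ _ (lose i′∈prev (from T-≡ (≡ᵇ≡true (toℕ i′)))))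

    -- The restriction of H: its vertices outside F, together with the old vertices i′ of the earlier blocks.
    R-oldBits R-newBits : ℕ → Bool
    R-oldBits n = (oldBit H n ∧ not (oldBit F n)) ∨ isPrev n
    R-newBits n = newBit H n ∧ not (newBit F n)

    R : Face d
    R = fromBits R-oldBits R-newBits

    R∋old⁻ : ∀ n → R ∋old n → (oldBit H n ∧ not (oldBit F n)) ≡ true ⊎ isPrev n ≡ true
    R∋old⁻ n e = ∨≡true⁻ (trans (sym (oldBit-fromBits R-oldBits R-newBits n (∋old⇒< R n e))) e)

    R∋new⁻ : ∀ n → R ∋new n → (newBit H n ∧ not (newBit F n)) ≡ true
    R∋new⁻ n e = trans (sym (newBit-fromBits R-oldBits R-newBits n (∋new⇒< R n e))) e

    R∋old-own : ∀ n → (oldBit H n ∧ not (oldBit F n)) ≡ true → R ∋old n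
    R∋old-own n e = trans (oldBit-fromBits R-oldBits R-newBits n (∋old⇒< H n (proj₁ (∧≡true⁻ e)))) (∨≡trueˡ e)

    R∋old-prev : ∀ {i′} → i′ ∈ₗ prev → R ∋old toℕ i′
    R∋old-prev {i′} i′∈prev =
      trans (oldBit-fromBits R-oldBits R-newBits (toℕ i′) (toℕ<n i′)) (∨≡trueʳ (isPrev⁺ i′∈prev))

    R∋new-own : ∀ n → (newBit H n ∧ not (newBit F n)) ≡ true → R ∋new n
    R∋new-own n e = trans (newBit-fromBits R-oldBits R-newBits n (∋new⇒< H n (proj₁ (∧≡true⁻ e)))) e

    R⊑H : R ⊑ H
    R⊑H = old-part , (λ n e → proj₁ (∧≡true⁻ (R∋new⁻ n e)))
      where
      old-part : ∀ n → R ∋old n → H ∋old n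
      old-part n e with R∋old⁻ n e
      ... | inj₁ own = proj₁ (∧≡true⁻ own)
      ... | inj₂ p with isPrev⁻ n p
      ...   | i′ , i′∈prev , refl = proj₁ (below (H-facet (toℕ i′)) (All.lookup prev<i i′∈prev))

    R⊈earlier : ∀ {G} → G ∈ₗ E → ¬ R ⊆ G
    R⊈earlier G∈E R⊆G with find (All.lookup sound G∈E)
    ... | i′ , i′∈prev , G-facet =
      false≢true (trans (sym (proj₁ (at (G-facet (toℕ i′)) refl))) (old⊑ (⊆⇒⊑ R⊆G) (toℕ i′) (R∋old-prev i′∈prev)))

    R⊈pre : ∀ {G} → G ∈ₗ pre → ¬ R ⊆ G
    R⊈pre {G} G∈pre R⊆G = φ-≽⇒¬DegLexLt i F G H (differs⇒φ-≽ i F G H differs-kept) (All.lookup (proj₁ around-H) G∈pre)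
      where
      G-facet = All.lookup members (∈L (List.∈-++⁺ˡ G∈pre))
      differs-kept : ∀ k → t < k → k < D₁ → differs F H k ≡ true → differs F G k ≡ true
      differs-kept k t<k k<D₁ = slotDiffers-transfer (oldBit F k) (newBit F k) (above (H-facet k) t<k k<D₁) (above (G-facet k) t<k k<D₁)
        (λ e → old⊑ (⊆⇒⊑ R⊆G) k (R∋old-own k e)) (λ e → new⊑ (⊆⇒⊑ R⊆G) k (R∋new-own k e))

    R-new : NewFace (E ++ pre) H R
    R-new = ⊑⇒⊆ R⊑H , All.tabulate R⊈
      where
      R⊈ : ∀ {G} → G ∈ₗ E ++ pre → ¬ R ⊆ G
      R⊈ G∈ = [ R⊈earlier , R⊈pre ]′ (List.∈-++⁻ E G∈)

    old-differs⇒above : ∀ n → H ∋old n → oldBit F n ≡ false → t < n × n < D₁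
    old-differs⇒above n n∈H n∉F with <-cmp n t | n <? D₁
    ... | tri< n<t _ _ | _ = ⊥-elim (false≢true (trans (sym n∉F) (proj₁ (below (F-facet n) n<t))))
    ... | tri≈ _ n≡t _ | _ = ⊥-elim (false≢true (trans (sym (proj₁ (at (H-facet n) n≡t))) n∈H))
    ... | tri> _ _ t<n | yes n<D₁ = t<n , n<D₁
    ... | tri> _ _ t<n | no n≮D₁ = ⊥-elim (false≢true (trans (sym (top (H-facet n) (≮⇒≥ n≮D₁))) n∈H))

    new-differs⇒above : ∀ n → H ∋new n → newBit F n ≡ false → t < n × n < D₁
    new-differs⇒above n n∈H n∉F with <-cmp n t
    ... | tri< n<t _ _ = ⊥-elim (false≢true (trans (sym (proj₂ (below (H-facet n) n<t))) n∈H))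
    ... | tri≈ _ n≡t _ = ⊥-elim (false≢true (trans (sym n∉F) (proj₂ (at (F-facet n) n≡t) (∋new⇒< H n n∈H))))
    ... | tri> _ _ t<n = t<n , ∋new⇒< H n n∈H

    module _ {S} (S⊑H : S ⊑ H) where
      -- Missing an old vertex i′ of an earlier block puts S into a facet of ◇(Γ_i′).
      prev-covers : ∀ {i′} → i′ ∈ₗ prev → ¬ S ∋old toℕ i′ → Σ (Face d) λ G → G ∈ₗ E × S ⊑ G
      prev-covers {i′} i′∈prev i′∉S =
        setSlot H (toℕ i′) false true ,
        covers i′∈prev _ (ModelFacet-lower H-facet i′<i (toℕ<n i)) ,
        ⊑-setSlot S⊑H (<-≤-trans i′<i (m<1+n⇒m≤n (toℕ<n i))) (λ e → ⊥-elim (i′∉S e)) (λ _ → refl)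
        where i′<i = All.lookup prev<i i′∈prev

      -- Missing the vertex of H at a slot n where H and F differ puts S into the facet H with F's
      -- choice at n, which precedes H in degree lexicographic order.
      swap-covers : ∀ n → t < n → n < D₁ → oldBit H n ≢ oldBit F n →
                    (S ∋old n → F ∋old n) → (S ∋new n → F ∋new n) → Σ (Face d) λ G → G ∈ₗ pre × S ⊑ G
      swap-covers n t<n n<D₁ H≢F old⇒F new⇒F =
        G , φ-≽⇒∈pre G (ModelFacet-swap H-facet t<n n<D₁ F-slot) G≢H (φ-≽-setSlot-as-F i F H n n<D₁ F-slot) ,
        ⊑-setSlot S⊑H n<D₁ old⇒F new⇒F
        where
        F-slot = above (F-facet n) t<n n<D₁
        G = setSlot H n (oldBit F n) (newBit F n)
        G≢H : G ≢ H
        G≢H G≡H = H≢F (trans (cong (λ U → oldBit U n) (sym G≡H)) (oldBit-setSlot-≡ H n _ _ (m<n⇒m<1+n n<D₁)))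

    R-least : ∀ S → NewFace (E ++ pre) H S → R ⊆ S
    R-least S (S⊆H , S-new) = ⊑⇒⊆ (old-part , new-part)
      where
      S⊑H = ⊆⇒⊑ S⊆H
      uncovered : ∀ {G} → G ∈ₗ E ++ pre → ¬ S ⊑ G
      uncovered G∈ S⊑G = All.lookup S-new G∈ (⊑⇒⊆ S⊑G)
      old-part : ∀ n → R ∋old n → S ∋old n
      old-part n e with ≡true? (oldBit S n) | R∋old⁻ n e
      ... | yes n∈S | _ = n∈S
      ... | no n∉S | inj₂ p with isPrev⁻ n p
      ...   | i′ , i′∈prev , refl = let G , G∈E , S⊑G = prev-covers S⊑H i′∈prev n∉S in
                                    ⊥-elim (uncovered (List.∈-++⁺ˡ G∈E) S⊑G)
      old-part n e | no n∉S | inj₁ own =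
        let _ , G∈pre , S⊑G = swap-covers S⊑H n t<n n<D₁ (λ eq → false≢true (trans (sym n∉F) (trans (sym eq) n∈H)))
                                (λ e → ⊥-elim (n∉S e)) (λ _ → OneOf-false₁ (above (F-facet n) t<n n<D₁) n∉F)
        in ⊥-elim (uncovered (List.∈-++⁺ʳ E G∈pre) S⊑G)
        where
        n∈H = proj₁ (∧≡true⁻ own)
        n∉F = not≡true⁻ (proj₂ (∧≡true⁻ own))
        t<n = proj₁ (old-differs⇒above n n∈H n∉F)
        n<D₁ = proj₂ (old-differs⇒above n n∈H n∉F)
      new-part : ∀ n → R ∋new n → S ∋new n
      new-part n e with ≡true? (newBit S n)
      ... | yes n∈S = n∈S
      ... | no n∉S =
        let _ , G∈pre , S⊑G = swap-covers S⊑H n t<n n<D₁ (λ eq → false≢true (trans (sym n∉H-old) (trans eq n∈F-old)))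
                                (λ _ → n∈F-old) (λ e → ⊥-elim (n∉S e))
        in ⊥-elim (uncovered (List.∈-++⁺ʳ E G∈pre) S⊑G)
        where
        own = R∋new⁻ n e
        n∈H = proj₁ (∧≡true⁻ own)
        n∉F = not≡true⁻ (proj₂ (∧≡true⁻ own))
        t<n = proj₁ (new-differs⇒above n n∈H n∉F)
        n<D₁ = proj₂ (new-differs⇒above n n∈H n∉F)
        n∈F-old = OneOf-false₂ (above (F-facet n) t<n n<D₁) n∉F
        n∉H-old = OneOf-true₂ (above (H-facet n) t<n n<D₁) n∈H

    unique-minimal : HasUniqueMinimal (E ++ pre) H
    unique-minimal = least-new⇒HasUniqueMinimal R R-new R-least

  Block-extends : ∀ {i F L} → Block i F L → ∀ {prev} → All (λ i′ → toℕ i′ < toℕ i) prev →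
                  ∀ {E} → Enumerates prev E → ExtendsShelling E L
  Block-extends block prev<i earlier pre H post L≡ = Position.unique-minimal block prev<i earlier pre H post L≡

  Blocks : List (Fin D₂) → List (List (Face d)) → Set
  Blocks = Pointwise (λ i L → Σ (Face d) λ F → Block i F L)

  Block-distinct : ∀ {i F L} → Block i F L → AllPairs _≢_ L
  Block-distinct {i} {F} block =
    AllPairs.map (λ {G} G<H G≡H → DegLexLt-irrefl i F G (subst (DegLexLt i F G) (sym G≡H) G<H)) (Block.sorted block)

  Enumerates-∷ : ∀ {i F L is Hs} → Block i F L → Enumerates is Hs → Enumerates (i ∷ is) (L ++ Hs)
  Enumerates-∷ {L = L} block enum = record
    { covers = λ { (here refl) G G-facet → List.∈-++⁺ˡ (Block.exhaustive block G G-facet)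
                 ; (there i∈is) G G-facet → List.∈-++⁺ʳ L (Enumerates.covers enum i∈is G G-facet) }
    ; sound = All.++⁺ (All.map here (Block.members block)) (All.map there (Enumerates.sound enum)) }

  Enumerates-∷ʳ : ∀ {i F L is Hs} → Block i F L → Enumerates is Hs → Enumerates (i ∷ is) (Hs ++ L)
  Enumerates-∷ʳ {Hs = Hs} block enum = record
    { covers = λ { (here refl) G G-facet → List.∈-++⁺ʳ Hs (Block.exhaustive block G G-facet)
                 ; (there i∈is) G G-facet → List.∈-++⁺ˡ (Enumerates.covers enum i∈is G G-facet) }
    ; sound = All.++⁺ (All.map there (Enumerates.sound enum)) (All.map here (Block.members block)) }

  blocks-shelling : ∀ {prev E is Ls} → Enumerates prev E → All (λ i′ → All (λ i → toℕ i′ < toℕ i) is) prev →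
                    AllPairs (λ i j → toℕ i < toℕ j) is → Blocks is Ls →
                    ExtendsShelling E (concat Ls) × Enumerates is (concat Ls) × AllPairs _≢_ (concat Ls)
  blocks-shelling {E = E} _ _ [] [] = ExtendsShelling-[] E , record { covers = λ () ; sound = [] } , []
  blocks-shelling {prev} {E} {i ∷ is} earlier prev<is (i<is ∷ is-sorted) ((F , block) ∷ blocks)
    with blocks-shelling (Enumerates-∷ʳ block earlier) (i<is ∷ All.map All.tail prev<is) is-sorted blocks
  ... | rest-extends , rest-enum , rest-distinct =
    ExtendsShelling-++ E _ _ (Block-extends block (All.map All.head prev<is) earlier) rest-extends ,
    Enumerates-∷ block rest-enum ,
    AllPairs.++⁺ (Block-distinct block) rest-distinct
      (All.map (λ G-facet → All.map (λ H-facet → distinct G-facet H-facet) (Enumerates.sound rest-enum)) (Block.members block))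
    where
    distinct : ∀ {G H} → ModelFacet (toℕ i) G → Any (λ j → ModelFacet (toℕ j) H) is → G ≢ H
    distinct G-facet H-facet with find H-facet
    ... | j , j∈is , H-facetⱼ = ModelFacet-distinct G-facet H-facetⱼ (All.lookup i<is j∈is)

  Enumerates⇒facets : ∀ {is Hs} → Enumerates is Hs → All (IsFacet (Diamond (GenCx is))) Hs
  Enumerates⇒facets {is} enum = All.map (from (IsFacet-Diamond⇔ModelFacet is _)) (Enumerates.sound enum)

  Enumerates⇒complete : ∀ {is Hs} → Enumerates is Hs → ∀ H → IsFacet (Diamond (GenCx is)) H → H ∈ₗ Hs
  Enumerates⇒complete {is} enum H H-facet with find (to (IsFacet-Diamond⇔ModelFacet is H) H-facet)
  ... | i , i∈is , H-model = Enumerates.covers enum i∈is H H-model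

  DegLexEnum⇒Block : ∀ {i F L} → DegLexEnum i F L → Block i F L
  DegLexEnum⇒Block {i} ((_ , refl) , sorted , facets , complete) = record
    { initial = All.head members
    ; members = members
    ; exhaustive = λ G G-facet → complete G (from (IsFacet-Diamond⇔ModelFacet-single i G) G-facet)
    ; sorted = sorted }
    where
    members = All.map (to (IsFacet-Diamond⇔ModelFacet-single i _)) facets

proposition4p4 : (d : ℕ) (i₁ : Fin (suc (suc d))) (is : List (Fin (suc (suc d))))
    → Linked Fin._<_ (i₁ ∷ is)
    → (F₁ : Face d) → IsFacet (Diamond (GenCx (i₁ ∷ []))) F₁
    → (L₁ : List (Face d)) → DegLexEnum i₁ F₁ L₁
    → (Ls : List (List (Face d))) → Pointwise (λ i L → DegLexEnum i (FIn i) L) is Ls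
    → IsShellingOrder (Diamond (GenCx (i₁ ∷ is))) (L₁ ++ concat Ls)
-- F₁ is a facet already because it heads L₁.
proposition4p4 d i₁ is increasing F₁ _ L₁ L₁-enum Ls Ls-enum =
  Diamond-pure (i₁ ∷ is) , distinct , Enumerates⇒facets enumerates , Enumerates⇒complete enumerates ,
  ExtendsShelling⇒unique-minimal (L₁ ++ concat Ls) extends
  where
  open ModelFacets d
  open Shellings d
  open BlockShelling d
  blocks : Blocks (i₁ ∷ is) (L₁ ∷ Ls)
  blocks = (F₁ , DegLexEnum⇒Block L₁-enum) ∷ Pointwise.map (λ {i} enum → FIn i , DegLexEnum⇒Block enum) Ls-enum
  shelling : ExtendsShelling [] (L₁ ++ concat Ls) × Enumerates (i₁ ∷ is) (L₁ ++ concat Ls) × AllPairs _≢_ (L₁ ++ concat Ls)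
  shelling = blocks-shelling (record { covers = λ () ; sound = [] }) [] (Linked⇒AllPairs Fin.<-trans increasing) blocks
  extends = proj₁ shelling
  enumerates = proj₁ (proj₂ shelling)
  distinct = proj₂ (proj₂ shelling)
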